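{- Let $\mathbf{k}$ be a commutative ring, $n$ a positive integer and $q\in\mathbf{k}$ invertible. For $I,K\subseteq[n-1]$, the coefficient of $\mathbf{B}_K$ in the expansion of $\mathbf{V}_n^{(q)}\mathbf{B}_I$ in the $\mathbf{B}$-basis of $\Sigma_n$ is $0$ if $I\not\subseteq K$, and if $I\subseteq K$ it equals \[ [\mathbf{B}_K]\,\mathbf{V}_n^{(q)}\mathbf{B}_I=(-1)^{|K|}\,q^{n-1}\,(1-q^{ -1})^{|I|}\prod_{v\in\overline{K|I}}[v]_{q^{ -1}}, \] where the product runs over the entries of the sequence $\overline{K|I}$ (with multiplicity) and $[v]_r=r^0+r^1+\cdots+r^{v-1}$.
   Context: $[m]=\{1,\dots,m\}$; $S_n$ is the symmetric group on $[n]$, and products in $\mathbf{k}S_n$ are given by composition, $(\pi\sigma)(i)=\pi(\sigma(i))$. $\operatorname{Des}(\pi)=\{i\in[n-1]:\pi(i)>\pi(i+1)\}$. For $I\subseteq[n-1]$: $\mathbf{D}_I=\sum_{\operatorname{Des}(\pi)=I}\pi$ and $\mathbf{B}_I=\sum_{\operatorname{Des}(\pi)\subseteq I}\pi$; these form two bases of the descent algebra $\Sigma_n\subseteq\mathbf{k}S_n$, and $[\mathbf{B}_K]f$ is the coefficient of $\mathbf{B}_K$ in $f$. A V-permutation is $w\in S_n$ with $w(1)>\cdots>w(k)<w(k+1)<\cdots<w(n)$ for some $k\in[n]$; $\mathbf{V}_n^{(q)}=\sum_{w\text{ V-permutation}}(-q)^{w^{ -1}(1)-1}w$. For $I=\{i_1<\dots<i_p\}\subseteq[n-1]$,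 $\operatorname{comp}(I)=(i_1,i_2-i_1,\dots,n-i_p)$. If $I\subseteq K$, $\operatorname{comp}(K)$ splits uniquely into consecutive blocks whose sums are the successive entries of $\operatorname{comp}(I)$; $\overline{K|I}$ is the sequence of the last entries of these blocks (length $|I|+1$). -}

module Defs where

open import Level using (Level)
open import Data.Nat as ℕ using (ℕ; zero; suc)
open import Data.Bool using (Bool; true; false; if_then_else_; _∧_; _∨_; not)
open import Data.Fin as F using (Fin; toℕ; inject₁)
open import Data.Fin.Properties using (_≟_)
open import Data.Fin.Subset using (Subset; inside; outside)
open import Data.List as L using (List; []; _∷_; filter; concatMap; allFin)
open import Data.Vec as V using (Vec; []; _∷_)
open import Relation.Nullary.Decidable using (⌊_⌋; yes; no)
open import Algebra.Bundles using (CommutativeRing)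
import Algebra.Bundles
import Algebra.Definitions.RawSemiring as RS

anyB : ∀ {a} {A : Set a} → (A → Bool) → List A → Bool
anyB p []       = false
anyB p (x ∷ xs) = p x ∨ anyB p xs

allB : ∀ {a} {A : Set a} → (A → Bool) → List A → Bool
allB p []       = true
allB p (x ∷ xs) = p x ∧ allB p xs

allVecs : ∀ {a} {A : Set a} → List A → (m : ℕ) → List (Vec A m)
allVecs xs zero    = [] ∷ []
allVecs xs (suc m) = concatMap (λ x → L.map (x ∷_) (allVecs xs m)) xs

Map : ℕ → Set
Map n = Fin n → Fin n

_==_ : ∀ {n} → Fin n → Fin n → Bool
i == j = ⌊ i ≟ j ⌋

_<ᵇ_ : ∀ {n} → Fin n → Fin n → Bool
i <ᵇ j = toℕ i ℕ.<ᵇ toℕ j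

isInjective : ∀ {n} → Map n → Bool
isInjective {n} f =
  allB (λ i → allB (λ j → not (f i == f j) ∨ (i == j)) (allFin n)) (allFin n)

Sym : (n : ℕ) → List (Map n)
Sym n = filter (λ f → isInjective f Data.Bool.≟ true)
               (L.map V.lookup (allVecs (allFin n) n))

_∘ₚ_ : ∀ {n} → Map n → Map n → Map n
(π ∘ₚ σ) i = π (σ i)

eqMap : ∀ {n} → Map n → Map n → Bool
eqMap {n} f g = allB (λ i → f i == g i) (allFin n)

-- Descents.  We take n = suc m, so [n-1] = {1..m} is encoded by Fin m
-- (index i : Fin m stands for the position i+1), and subsets of [n-1]
-- are Subset m (inside = member).

-- i+1 ∈ Des(π)  (positions i+1, i+2 are inject₁ i, suc i in 0-based Fin)
isDescent : ∀ {m} → Map (suc m) → Fin m → Bool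
isDescent π i = π (F.suc i) <ᵇ π (inject₁ i)

memB : ∀ {m} → Fin m → Subset m → Bool
memB i K = V.lookup K i

desSubsetB : ∀ {m} → Map (suc m) → Subset m → Bool
desSubsetB {m} π K = allB (λ i → not (isDescent π i) ∨ memB i K) (allFin m)

-- V-permutation: w(1) > ... > w(k) < w(k+1) < ... < w(n) for some k ∈ [n]
-- (k ranges over Fin (suc m), the 0-based index k-1; position i+1 → i+2
--  must be a descent iff i+1 < k)
isVPerm : ∀ {m} → Map (suc m) → Bool
isVPerm {m} w =
  anyB (λ k → allB (λ i → if toℕ i ℕ.<ᵇ toℕ k
                            then isDescent w i
                            else (w (inject₁ i) <ᵇ w (F.suc i)))
                   (allFin m))
       (allFin (suc m))

-- first (0-based) index j with p j = true; returns n if none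
firstIndex : ∀ {n} → (Fin n → Bool) → ℕ
firstIndex {zero}  p = zero
firstIndex {suc n} p = if p F.zero then zero else suc (firstIndex (λ j → p (F.suc j)))

-- w⁻¹(1) - 1  (= 0-based position of the value 1, i.e. Fin.zero)
invOneMinusOne : ∀ {n} → Map (suc n) → ℕ
invOneMinusOne w = firstIndex (λ j → w j == F.zero)

allSubsets : (m : ℕ) → List (Subset m)
allSubsets m = allVecs (inside ∷ outside ∷ []) m

compAux : ∀ {k} → Subset k → ℕ → List ℕ
compAux []             c = c ∷ []
compAux (true  ∷ bs)   c = c ∷ compAux bs 1
compAux (false ∷ bs)   c = compAux bs (suc c)

-- comp(I) = (i₁, i₂ - i₁, …, n - i_p) for I ⊆ [n-1] = Subset m, n = suc m
comp : ∀ {m} → Subset m → List ℕ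
comp I = compAux I 1

-- Split the list of parts into consecutive blocks whose sums are the
-- successive targets; output the last entry of each block.
-- (acc = sum of the parts of the current block seen so far)
blockLasts : List ℕ → List ℕ → ℕ → List ℕ
blockLasts []       ps       acc = []
blockLasts (t ∷ ts) []       acc = []
blockLasts (t ∷ ts) (p ∷ ps) acc =
  if (acc ℕ.+ p) ℕ.≡ᵇ t then p ∷ blockLasts ts ps 0
                        else blockLasts (t ∷ ts) ps (acc ℕ.+ p)

overline : ∀ {m} → Subset m → Subset m → List ℕ
overline K I = blockLasts (comp I) (comp K) 0

module Alg {c ℓ : Level} (R : CommutativeRing c ℓ) where
  open CommutativeRing R
  open RS (Algebra.Bundles.Semiring.rawSemiring semiring) public using (_^_)

  sumL : List Carrier → Carrier
  sumL = L.foldr _+_ 0#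

  prodL : List Carrier → Carrier
  prodL = L.foldr _*_ 1#

  [1or0] : Bool → Carrier
  [1or0] true  = 1#
  [1or0] false = 0#

  -- element of kS_n, given by its coefficient function
  KS : ℕ → Set c
  KS n = Map n → Carrier

  _⋆_ : ∀ {n} → KS n → KS n → KS n
  _⋆_ {n} f g π =
    sumL (L.map (λ α → sumL (L.map (λ β →
      [1or0] (eqMap (α ∘ₚ β) π) * (f α * g β)) (Sym n))) (Sym n))

  𝐁 : ∀ {m} → Subset m → KS (suc m)
  𝐁 K π = [1or0] (desSubsetB π K)

  𝐕 : ∀ {m} → Carrier → KS (suc m)
  𝐕 q w = [1or0] (isVPerm w) * ((- q) ^ invOneMinusOne w)

  qint : ℕ → Carrier → Carrier
  qint v r = sumL (L.map (r ^_) (L.upTo v))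

-- For A ⊆ {2,…,n} let w_A be the V-permutation listing A ∪ {1} in decreasing order and then the other
-- values in increasing order.  Every V-permutation is some w_A and w_A⁻¹(1) − 1 = |A|, so the
-- coefficient of π in V B_I is Σ_A (−q)^|A| [Des(w_A⁻¹ π) ⊆ I].  Position i is a descent of w_A⁻¹ π
-- exactly when the larger of π(i), π(i+1) lies in A ∪ {1} and i ∉ Des π, or lies outside it and
-- i ∈ Des π.  Each condition thus concerns a single value, the sum over A factorises, and back at
-- positions it becomes the product over p ≠ π⁻¹(1) of
--   −q [p − 1 is not an ascent outside I] + [p is not a descent outside I].
-- This product, and also the sum over K ⊇ I ∪ Des π of the claimed coefficients, obey one two-state
-- recursion in the pair (I, Des π) read from left to right; for the sum it rests on
-- q (1 − q⁻¹) = q − 1 and q ([v+1]_{q⁻¹} − 1) = [v]_{q⁻¹}.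

module Submission where

open import Defs
open import Level using (Level)
open import Function using (_∘_; id; Equivalence)
open import Function.Definitions using (Injective)
open import Data.Bool as Bool using (Bool; true; false; T; not; _∧_; _∨_; if_then_else_)
open import Data.Bool.Properties using (T-∧; T-≡)
import Data.Bool.Properties as Boolₚ
open import Data.Nat as Nat using (ℕ; zero; suc)
import Data.Nat.Properties as ℕₚ
open import Data.Fin as Fin using (Fin; zero; suc; toℕ; inject₁)
import Data.Fin.Properties as Finₚ
open import Data.Fin.Subset using (Subset; inside; outside; ∣_∣; _⊆_; _∈_)
open import Data.Fin.Subset.Properties
  using (p⊂q⇒∣p∣<∣q∣; p⊆q⇒∣p∣≤∣q∣; ⊆⊤; ∈⊤; ∣⊤∣≡n; drop-∷-⊆; _⊆?_)
open import Data.Fin.Induction using (<-weakInduction; >-weakInduction)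
import Data.Fin.Permutation as Perm
import Algebra.Solver.CommutativeMonoid
open import Data.List as List using (List; []; _∷_; _++_; allFin; concatMap; map)
open import Data.Vec as Vec using (Vec; []; _∷_; lookup; tabulate; here)
open import Data.Vec.Functional using (removeAt)
import Data.Vec.Properties as Vecₚ
open import Data.Product using (∃; _,_; _×_; proj₁; proj₂)
open import Data.Empty using (⊥-elim)
open import Relation.Nullary using (¬_; Dec; yes; no; does)
open import Relation.Nullary.Decidable using (toWitness; fromWitness; dec-true; dec-false)
open import Relation.Binary using (DecidableEquality; tri<; tri≈; tri>)
open import Relation.Binary.PropositionalEquality as ≡ using (_≡_; _≢_; _≗_)
open import Algebra.Bundles using (CommutativeRing)

module _ where
  open ≡ using (refl; sym; trans; cong; cong₂; subst)

  T-injective : ∀ {a b} → (T a → T b) → (T b → T a) → a ≡ b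
  T-injective {false} {false} _ _ = refl
  T-injective {false} {true}  _ f = ⊥-elim (f _)
  T-injective {true}  {false} f _ = ⊥-elim (f _)
  T-injective {true}  {true}  _ _ = refl

  T-≡-does : ∀ {p} {P : Set p} {b} (P? : Dec P) → (T b → P) → (P → T b) → b ≡ does P?
  T-≡-does (yes p) _  P→b = T-injective (λ _ → _) (λ _ → P→b p)
  T-≡-does (no ¬p) b→P _  = T-injective (¬p ∘ b→P) (λ ())

  module _ {a} {A : Set a} (p : A → Bool) where

    allB-tabulate⁺ : ∀ {n} (g : Fin n → A) → (∀ i → T (p (g i))) → T (allB p (List.tabulate g))
    allB-tabulate⁺ {zero}  g h = _
    allB-tabulate⁺ {suc n} g h =
      Equivalence.from (T-∧ {p (g zero)}) (h zero , allB-tabulate⁺ (g ∘ suc) (h ∘ suc))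

    allB-tabulate⁻ : ∀ {n} (g : Fin n → A) → T (allB p (List.tabulate g)) → ∀ i → T (p (g i))
    allB-tabulate⁻ {suc n} g h zero    = proj₁ (Equivalence.to (T-∧ {p (g zero)}) h)
    allB-tabulate⁻ {suc n} g h (suc i) =
      allB-tabulate⁻ (g ∘ suc) (proj₂ (Equivalence.to (T-∧ {p (g zero)}) h)) i

    anyB-tabulate⁺ : ∀ {n} (g : Fin n → A) i → T (p (g i)) → T (anyB p (List.tabulate g))
    anyB-tabulate⁺ g zero h with p (g zero)
    ... | true = _
    anyB-tabulate⁺ g (suc i) h with p (g zero)
    ... | true  = _
    ... | false = anyB-tabulate⁺ (g ∘ suc) i h

    anyB-tabulate⁻ : ∀ {n} (g : Fin n → A) → T (anyB p (List.tabulate g)) → ∃ λ i → T (p (g i))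
    anyB-tabulate⁻ {suc n} g h with p (g zero) in eq
    ... | true  = zero , subst T (sym eq) _
    ... | false = let i , hi = anyB-tabulate⁻ (g ∘ suc) h in suc i , hi

  module _ {a} {A : Set a} {p p′ : A → Bool} (p≗p′ : p ≗ p′) where

    allB-cong : ∀ xs → allB p xs ≡ allB p′ xs
    allB-cong []       = refl
    allB-cong (x ∷ xs) = cong₂ _∧_ (p≗p′ x) (allB-cong xs)

    anyB-cong : ∀ xs → anyB p xs ≡ anyB p′ xs
    anyB-cong []       = refl
    anyB-cong (x ∷ xs) = cong₂ _∨_ (p≗p′ x) (anyB-cong xs)

  T-not⇒¬T : ∀ {b} → T (not b) → ¬ T b
  T-not⇒¬T {false} _ ()

  ==⁺ : ∀ {n} {i j : Fin n} → i ≡ j → T (i == j)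
  ==⁺ = fromWitness

  ==⁻ : ∀ {n} {i j : Fin n} → T (i == j) → i ≡ j
  ==⁻ = toWitness

  module _ {n : ℕ} {f g : Map n} where

    eqMap⁺ : f ≗ g → T (eqMap f g)
    eqMap⁺ f≗g = allB-tabulate⁺ _ id (==⁺ ∘ f≗g)

    eqMap⁻ : T (eqMap f g) → f ≗ g
    eqMap⁻ h = ==⁻ ∘ allB-tabulate⁻ _ id h

  module _ {n : ℕ} {f : Map n} where

    isInjective⁺ : Injective _≡_ _≡_ f → T (isInjective f)
    isInjective⁺ inj = allB-tabulate⁺ _ id λ i → allB-tabulate⁺ _ id (entry i)
      where
      entry : ∀ i j → T (not (f i == f j) ∨ (i == j))
      entry i j with f i Finₚ.≟ f j
      ... | yes fi≡fj = ==⁺ (inj fi≡fj)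
      ... | no  _     = _

    isInjective⁻ : T (isInjective f) → Injective _≡_ _≡_ f
    isInjective⁻ h {i} {j} fi≡fj = ==⁻ (entry (allB-tabulate⁻ _ id (allB-tabulate⁻ _ id h i) j))
      where
      entry : T (not (f i == f j) ∨ (i == j)) → T (i == j)
      entry with f i Finₚ.≟ f j
      ... | yes _     = id
      ... | no  fi≢fj = ⊥-elim (fi≢fj fi≡fj)

  desSubsetB≡⊆? : ∀ {m} (π : Map (suc m)) K → desSubsetB π K ≡ does (tabulate (isDescent π) ⊆? K)
  desSubsetB≡⊆? {m} π K = T-≡-does (tabulate (isDescent π) ⊆? K) to from
    where
    ∈-descents⁻ : ∀ {i} → i ∈ tabulate (isDescent π) → isDescent π i ≡ true
    ∈-descents⁻ {i} i∈ = trans (sym (Vecₚ.lookup∘tabulate (isDescent π) i)) (Vecₚ.[]=⇒lookup i∈)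
    to : T (desSubsetB π K) → tabulate (isDescent π) ⊆ K
    to h {i} i∈ = Vecₚ.lookup⇒[]= i K (Equivalence.to T-≡ (entry (allB-tabulate⁻ _ id h i)))
      where
      entry : T (not (isDescent π i) ∨ lookup K i) → T (lookup K i)
      entry rewrite ∈-descents⁻ i∈ = id
    from : tabulate (isDescent π) ⊆ K → T (desSubsetB π K)
    from D⊆K = allB-tabulate⁺ _ id entry
      where
      entry : ∀ i → T (not (isDescent π i) ∨ lookup K i)
      entry i with isDescent π i in d
      ... | false = _
      ... | true  = Equivalence.from T-≡ (Vecₚ.[]=⇒lookup (D⊆K i∈D))
        where
        i∈D : i ∈ tabulate (isDescent π)
        i∈D = Vecₚ.lookup⇒[]= i _ (trans (Vecₚ.lookup∘tabulate _ i) d)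

  firstIndex-cong : ∀ {n} {p p′ : Fin n → Bool} → p ≗ p′ → firstIndex p ≡ firstIndex p′
  firstIndex-cong {zero}  _    = refl
  firstIndex-cong {suc n} p≗p′ =
    cong₂ (λ b k → if b then zero else suc k) (p≗p′ zero) (firstIndex-cong (p≗p′ ∘ suc))

  firstIndex-unique : ∀ {n} (p : Fin n → Bool) {x} → T (p x) → (∀ y → T (p y) → y ≡ x) →
                      firstIndex p ≡ toℕ x
  firstIndex-unique p {zero}  px _ with p zero
  ... | true = refl
  firstIndex-unique p {suc x} px unique with p zero in eq
  ... | true  with () ← unique zero (subst T (sym eq) _)
  ... | false = cong suc (firstIndex-unique (p ∘ suc) px (λ y → Finₚ.suc-injective ∘ unique (suc y)))

  module _ {m : ℕ} {f g : Map (suc m)} (f≗g : f ≗ g) where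

    isDescent-cong : ∀ i → isDescent f i ≡ isDescent g i
    isDescent-cong i = cong₂ _<ᵇ_ (f≗g (suc i)) (f≗g (inject₁ i))

    desSubsetB-cong : ∀ K → desSubsetB f K ≡ desSubsetB g K
    desSubsetB-cong K = allB-cong (λ i → cong (λ b → not b ∨ memB i K) (isDescent-cong i)) (allFin m)

    isVPerm-cong : isVPerm f ≡ isVPerm g
    isVPerm-cong = anyB-cong (λ k → allB-cong (λ i → cong₂ (if_then_else_ _) (isDescent-cong i)
                                                      (cong₂ _<ᵇ_ (f≗g (inject₁ i)) (f≗g (suc i))))
                                              (allFin m))
                             (allFin (suc m))

    invOneMinusOne-cong : invOneMinusOne f ≡ invOneMinusOne g
    invOneMinusOne-cong = firstIndex-cong (cong (_== zero) ∘ f≗g)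

  eqMap-congˡ : ∀ {n} {f g : Map n} (h : Map n) → f ≗ g → eqMap f h ≡ eqMap g h
  eqMap-congˡ {n} h f≗g = allB-cong (λ i → cong (_== h i) (f≗g i)) (allFin n)

module _ where
  open ≡ using (refl; sym; trans; cong; subst)
  open import Data.Nat using (_<_; _≤_; z≤n; s≤s)

  injective⇒surjective : ∀ {n} {f : Fin n → Fin n} → Injective _≡_ _≡_ f → ∀ y → ∃ λ x → f x ≡ y
  injective⇒surjective {suc n} {f} f-inj y with Finₚ.any? (λ x → f x Finₚ.≟ y)
  ... | yes y∈img = y∈img
  ... | no  y∉img = ⊥-elim (ℕₚ.<-irrefl refl (Finₚ.injective⇒≤ {f = punchOut∘f} punchOut∘f-inj))
    where
    y≢f : ∀ x → y ≢ f x
    y≢f x y≡fx = y∉img (x , sym y≡fx)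
    punchOut∘f : Fin (suc n) → Fin n
    punchOut∘f x = Fin.punchOut (y≢f x)
    punchOut∘f-inj : Injective _≡_ _≡_ punchOut∘f
    punchOut∘f-inj = f-inj ∘ Finₚ.punchOut-injective (y≢f _) (y≢f _)

  module _ {n} {f : Fin n → Fin n} (f-inj : Injective _≡_ _≡_ f) where

    -- Opaque, so that conversion checking never runs the search behind it.
    opaque
      inverse : Fin n → Fin n
      inverse y = proj₁ (injective⇒surjective f-inj y)

      inverseʳ : ∀ y → f (inverse y) ≡ y
      inverseʳ y = proj₂ (injective⇒surjective f-inj y)

    inverseˡ : ∀ x → inverse (f x) ≡ x
    inverseˡ x = f-inj (inverseʳ (f x))

    inverse-injective : Injective _≡_ _≡_ inverse
    inverse-injective {y} {y′} e = trans (sym (inverseʳ y)) (trans (cong f e) (inverseʳ y′))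

    asPermutation : Perm.Permutation n n
    asPermutation = Perm.permutation f inverse inverseʳ inverseˡ

  inject₁≢suc : ∀ {n} (i : Fin n) → inject₁ i ≢ suc i
  inject₁≢suc i e = ℕₚ.1+n≢n (sym (trans (sym (Finₚ.toℕ-inject₁ i)) (cong toℕ e)))

  ascending⇒≗id : ∀ {n} (f : Fin (suc n) → Fin (suc n)) → (∀ i → f (inject₁ i) Fin.< f (suc i)) → f ≗ id
  ascending⇒≗id {n} f asc i = Finₚ.toℕ-injective (ℕₚ.≤-antisym (upper i) (lower i))
    where
    lower : ∀ i → toℕ i ≤ toℕ (f i)
    lower = <-weakInduction (λ i → toℕ i ≤ toℕ (f i)) z≤n step
      where
      step : ∀ i → toℕ (inject₁ i) ≤ toℕ (f (inject₁ i)) → toℕ (suc i) ≤ toℕ (f (suc i))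
      step i i≤fi = ℕₚ.≤-<-trans (subst (_≤ toℕ (f (inject₁ i))) (Finₚ.toℕ-inject₁ i) i≤fi) (asc i)
    upper : ∀ i → toℕ (f i) ≤ toℕ i
    upper = >-weakInduction (λ i → toℕ (f i) ≤ toℕ i) base step
      where
      base : toℕ (f (Fin.fromℕ n)) ≤ toℕ (Fin.fromℕ n)
      base = subst (toℕ (f (Fin.fromℕ n)) ≤_) (sym (Finₚ.toℕ-fromℕ n))
                   (Finₚ.toℕ≤pred[n] (f (Fin.fromℕ n)))
      step : ∀ i → toℕ (f (suc i)) ≤ toℕ (suc i) → toℕ (f (inject₁ i)) ≤ toℕ (inject₁ i)
      step i fi+1≤i+1 = subst (toℕ (f (inject₁ i)) ≤_) (sym (Finₚ.toℕ-inject₁ i))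
                              (Nat.s≤s⁻¹ (ℕₚ.<-≤-trans (asc i) fi+1≤i+1))

module Rank {n} (key : Fin n → ℕ) where
  open ≡ using (refl; sym; trans; cong; subst)
  open import Data.Nat using (_<_; _≤_)

  below : ℕ → Subset n
  below k = tabulate (λ y → key y Nat.<ᵇ k)

  ∈-below⁺ : ∀ {y k} → key y < k → y ∈ below k
  ∈-below⁺ {y} lt =
    Vecₚ.lookup⇒[]= y _ (trans (Vecₚ.lookup∘tabulate _ y) (Equivalence.to T-≡ (ℕₚ.<⇒<ᵇ lt)))

  ∈-below⁻ : ∀ {y k} → y ∈ below k → key y < k
  ∈-below⁻ {y} {k} y∈ = ℕₚ.<ᵇ⇒< (key y) k
    (Equivalence.from T-≡ (trans (sym (Vecₚ.lookup∘tabulate _ y)) (Vecₚ.[]=⇒lookup y∈)))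

  rank : Fin n → ℕ
  rank x = ∣ below (key x) ∣

  rank<n : ∀ x → rank x < n
  rank<n x = subst (rank x <_) (∣⊤∣≡n n)
    (p⊂q⇒∣p∣<∣q∣ (⊆⊤ , x , ∈⊤ , λ x∈ → ℕₚ.<-irrefl refl (∈-below⁻ x∈)))

  rank-mono-< : ∀ {x y} → key x < key y → rank x < rank y
  rank-mono-< {x} lt =
    p⊂q⇒∣p∣<∣q∣ ((λ z∈ → ∈-below⁺ (ℕₚ.<-trans (∈-below⁻ z∈) lt)) , x , ∈-below⁺ lt ,
                 λ x∈ → ℕₚ.<-irrefl refl (∈-below⁻ x∈))

  rank-mono-≤ : ∀ {x y} → key x ≤ key y → rank x ≤ rank y
  rank-mono-≤ le = p⊆q⇒∣p∣≤∣q∣ (λ z∈ → ∈-below⁺ (ℕₚ.<-≤-trans (∈-below⁻ z∈) le))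

  rank-cancel-< : ∀ {x y} → rank x < rank y → key x < key y
  rank-cancel-< lt = ℕₚ.≰⇒> (ℕₚ.<⇒≱ lt ∘ rank-mono-≤)

  rank-cancel-≤ : ∀ {x y} → rank x ≤ rank y → key x ≤ key y
  rank-cancel-≤ le = ℕₚ.≮⇒≥ (ℕₚ.≤⇒≯ le ∘ rank-mono-<)

  rank-injective : Injective _≡_ _≡_ key → Injective _≡_ _≡_ rank
  rank-injective key-inj e =
    key-inj (ℕₚ.≤-antisym (rank-cancel-≤ (ℕₚ.≤-reflexive e)) (rank-cancel-≤ (ℕₚ.≤-reflexive (sym e))))

module _ where
  open ≡ using (refl; sym; trans; cong; cong₂; subst; subst₂)
  open import Data.Nat using (_+_; _∸_; _<_; _≤_; z≤n; s≤s)
  open import Relation.Nullary.Reflects using (ofʸ; ofⁿ)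

  <ᵇ-true : ∀ {u v} → u < v → (u Nat.<ᵇ v) ≡ true
  <ᵇ-true = Equivalence.to T-≡ ∘ ℕₚ.<⇒<ᵇ

  <ᵇ-false : ∀ {u v} → ¬ u < v → (u Nat.<ᵇ v) ≡ false
  <ᵇ-false {u} {v} u≮v with u Nat.<ᵇ v | ℕₚ.<ᵇ-reflects-< u v
  ... | true  | ofʸ u<v = ⊥-elim (u≮v u<v)
  ... | false | _       = refl

  <ᵇ-≢-suc : ∀ {u v} → u ≢ v → (u Nat.<ᵇ v) ≡ (u Nat.<ᵇ suc v)
  <ᵇ-≢-suc {u} {v} u≢v =
    T-injective (ℕₚ.<⇒<ᵇ ∘ ℕₚ.m<n⇒m<1+n ∘ ℕₚ.<ᵇ⇒< u v)
                (ℕₚ.<⇒<ᵇ ∘ (λ u≤v → ℕₚ.≤∧≢⇒< u≤v u≢v) ∘ Nat.s≤s⁻¹ ∘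
                 ℕₚ.<ᵇ⇒< u (suc v))

  armKey : ℕ → Bool → ℕ → ℕ
  armKey m true  v = m ∸ v
  armKey m false v = suc m + v

  module _ {m : ℕ} where

    on<off : ∀ u v → m ∸ u < suc m + v
    on<off u v = s≤s (ℕₚ.≤-trans (ℕₚ.m∸n≤m m u) (ℕₚ.m≤m+n m v))

    armKey≤m⇒T : ∀ b {v} → armKey m b v ≤ m → T b
    armKey≤m⇒T true  _  = _
    armKey≤m⇒T false le = ℕₚ.<⇒≱ (s≤s (ℕₚ.m≤m+n m _)) le

    T⇒armKey≤m : ∀ b {v} → T b → armKey m b v ≤ m
    T⇒armKey≤m true {v} _ = ℕₚ.m∸n≤m m v

    armKey-injective : ∀ a b {u v} → u ≤ m → v ≤ m → armKey m a u ≡ armKey m b v → u ≡ v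
    armKey-injective true  true  u≤m v≤m e = ℕₚ.∸-cancelˡ-≡ u≤m v≤m e
    armKey-injective false false _   _   e = ℕₚ.+-cancelˡ-≡ (suc m) _ _ e
    armKey-injective true  false {u} {v} _ _ e = ⊥-elim (ℕₚ.<-irrefl e (on<off u v))
    armKey-injective false true  {u} {v} _ _ e = ⊥-elim (ℕₚ.<-irrefl (sym e) (on<off v u))

    armKey-<ᵇ-< : ∀ a b {u v} → v ≤ m → u < v →
                  (armKey m b v Nat.<ᵇ armKey m a u) ≡ b × (armKey m a u Nat.<ᵇ armKey m b v) ≡ not b
    armKey-<ᵇ-< true  true  v≤m u<v =
      <ᵇ-true (ℕₚ.∸-monoʳ-< u<v v≤m) ,
      <ᵇ-false (ℕₚ.≤⇒≯ (ℕₚ.∸-monoʳ-≤ m (ℕₚ.<⇒≤ u<v)))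
    armKey-<ᵇ-< true  false {u} {v} _ _ = <ᵇ-false (ℕₚ.<-asym (on<off u v)) , <ᵇ-true (on<off u v)
    armKey-<ᵇ-< false true  {u} {v} _ _ = <ᵇ-true (on<off v u) , <ᵇ-false (ℕₚ.<-asym (on<off v u))
    armKey-<ᵇ-< false false _ u<v =
      <ᵇ-false (ℕₚ.<-asym (ℕₚ.+-monoʳ-< (suc m) u<v)) , <ᵇ-true (ℕₚ.+-monoʳ-< (suc m) u<v)

  -- Values are 0-based (the paper's value 1 is zero).  A : Subset m marks the values 1, …, m, and
  -- onArm A is A ∪ {0}: the values that w_A lists up to and including its minimum.
  onArm : ∀ {m} → Subset m → Fin (suc m) → Bool
  onArm A zero    = true
  onArm A (suc j) = lookup A j

  module _ {m : ℕ} (A : Subset m) where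

    -- Sorting by vKey lists the arm in decreasing order and then the other values in increasing
    -- order, so the rank of a value is its position in w_A.
    vKey : Fin (suc m) → ℕ
    vKey x = armKey m (onArm A x) (toℕ x)

    vKey-injective : Injective _≡_ _≡_ vKey
    vKey-injective {x} {y} =
      Finₚ.toℕ-injective ∘
      armKey-injective (onArm A x) (onArm A y) (Finₚ.toℕ≤pred[n] x) (Finₚ.toℕ≤pred[n] y)

    vKey≤m⇒onArm : ∀ {x} → vKey x ≤ m → T (onArm A x)
    vKey≤m⇒onArm {x} = armKey≤m⇒T (onArm A x)

    onArm⇒vKey≤m : ∀ {x} → T (onArm A x) → vKey x ≤ m
    onArm⇒vKey≤m {x} = T⇒armKey≤m (onArm A x)

    vKey-<ᵇ-< : ∀ {x y} → x Fin.< y →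
                (vKey y Nat.<ᵇ vKey x) ≡ onArm A y × (vKey x Nat.<ᵇ vKey y) ≡ not (onArm A y)
    vKey-<ᵇ-< {x} {y} = armKey-<ᵇ-< (onArm A x) (onArm A y) (Finₚ.toℕ≤pred[n] y)

    vKey-suc-<ᵇ-vKey-zero : ∀ j → (vKey (suc j) Nat.<ᵇ vKey zero) ≡ lookup A j
    vKey-suc-<ᵇ-vKey-zero j = proj₁ (vKey-<ᵇ-< {zero} {suc j} (s≤s z≤n))

    open Rank vKey
      using (below; rank; rank<n; rank-mono-<; rank-mono-≤; rank-cancel-<; rank-cancel-≤; rank-injective)

    -- Opaque for the same reason as inverse.
    opaque
      vPerm⁻¹ : Map (suc m)
      vPerm⁻¹ x = Fin.fromℕ< (rank<n x)

      toℕ-vPerm⁻¹ : ∀ x → toℕ (vPerm⁻¹ x) ≡ rank x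
      toℕ-vPerm⁻¹ x = Finₚ.toℕ-fromℕ< (rank<n x)

    vPerm⁻¹-injective : Injective _≡_ _≡_ vPerm⁻¹
    vPerm⁻¹-injective {x} {y} e =
      rank-injective vKey-injective (trans (sym (toℕ-vPerm⁻¹ x)) (trans (cong toℕ e) (toℕ-vPerm⁻¹ y)))

    vPerm : Map (suc m)
    vPerm = inverse vPerm⁻¹-injective

    vPerm⁻¹-<-cancel : ∀ {x y} → vPerm⁻¹ x Fin.< vPerm⁻¹ y → vKey x < vKey y
    vPerm⁻¹-<-cancel {x} {y} = rank-cancel-< {x} {y} ∘ subst₂ _<_ (toℕ-vPerm⁻¹ x) (toℕ-vPerm⁻¹ y)

    vPerm⁻¹-≤-cancel : ∀ {x y} → vPerm⁻¹ x Fin.≤ vPerm⁻¹ y → vKey x ≤ vKey y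
    vPerm⁻¹-≤-cancel {x} {y} = rank-cancel-≤ {x} {y} ∘ subst₂ _≤_ (toℕ-vPerm⁻¹ x) (toℕ-vPerm⁻¹ y)

    vPerm⁻¹-mono-< : ∀ {x y} → vKey x < vKey y → vPerm⁻¹ x Fin.< vPerm⁻¹ y
    vPerm⁻¹-mono-< {x} {y} = subst₂ _<_ (sym (toℕ-vPerm⁻¹ x)) (sym (toℕ-vPerm⁻¹ y)) ∘ rank-mono-< {x} {y}

    vPerm⁻¹-mono-≤ : ∀ {x y} → vKey x ≤ vKey y → vPerm⁻¹ x Fin.≤ vPerm⁻¹ y
    vPerm⁻¹-mono-≤ {x} {y} =
      subst₂ _≤_ (sym (toℕ-vPerm⁻¹ x)) (sym (toℕ-vPerm⁻¹ y)) ∘ rank-mono-≤ {x} {y}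

    vPerm⁻¹-<ᵇ : ∀ x y → (vPerm⁻¹ x <ᵇ vPerm⁻¹ y) ≡ (vKey x Nat.<ᵇ vKey y)
    vPerm⁻¹-<ᵇ x y =
      T-injective (ℕₚ.<⇒<ᵇ ∘ vPerm⁻¹-<-cancel {x} {y} ∘
                   ℕₚ.<ᵇ⇒< (toℕ (vPerm⁻¹ x)) (toℕ (vPerm⁻¹ y)))
                  (ℕₚ.<⇒<ᵇ ∘ vPerm⁻¹-mono-< {x} {y} ∘ ℕₚ.<ᵇ⇒< (vKey x) (vKey y))

    toℕ-vPerm⁻¹-zero : toℕ (vPerm⁻¹ zero) ≡ ∣ A ∣
    toℕ-vPerm⁻¹-zero = trans (toℕ-vPerm⁻¹ zero) (cong ∣_∣ below-m)
      where
      below-m : below (vKey zero) ≡ outside ∷ A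
      below-m = cong₂ _∷_ (<ᵇ-false {m} (ℕₚ.<-irrefl refl))
                          (trans (Vecₚ.tabulate-cong vKey-suc-<ᵇ-vKey-zero) (Vecₚ.tabulate∘lookup A))

    vPerm⁻¹∘vPerm : ∀ p → vPerm⁻¹ (vPerm p) ≡ p
    vPerm⁻¹∘vPerm = inverseʳ vPerm⁻¹-injective

    vPerm∘vPerm⁻¹ : ∀ x → vPerm (vPerm⁻¹ x) ≡ x
    vPerm∘vPerm⁻¹ = inverseˡ vPerm⁻¹-injective

    vPerm-injective : Injective _≡_ _≡_ vPerm
    vPerm-injective = inverse-injective vPerm⁻¹-injective

    onArm⇒vPerm⁻¹≤ : ∀ {x} → T (onArm A x) → vPerm⁻¹ x Fin.≤ vPerm⁻¹ zero
    onArm⇒vPerm⁻¹≤ {x} = vPerm⁻¹-mono-≤ {x} {zero} ∘ onArm⇒vKey≤m {x}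

    vPerm⁻¹≤⇒onArm : ∀ {x} → vPerm⁻¹ x Fin.≤ vPerm⁻¹ zero → T (onArm A x)
    vPerm⁻¹≤⇒onArm {x} = vKey≤m⇒onArm {x} ∘ vPerm⁻¹-≤-cancel {x} {zero}

    lookup-vPerm⁻¹ : ∀ j → lookup A j ≡ (vPerm⁻¹ (suc j) <ᵇ vPerm⁻¹ zero)
    lookup-vPerm⁻¹ j = trans (sym (vKey-suc-<ᵇ-vKey-zero j)) (sym (vPerm⁻¹-<ᵇ (suc j) zero))

    vKey-<ᵇ : ∀ {x y} → x ≢ y → (vKey y Nat.<ᵇ vKey x) ≡ (if y <ᵇ x then not (onArm A x) else onArm A y)
    vKey-<ᵇ {x} {y} x≢y with Finₚ.<-cmp y x
    ... | tri< y<x _ _ = trans (proj₂ (vKey-<ᵇ-< y<x)) (cong pick (sym (<ᵇ-true y<x)))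
      where
      pick : Bool → Bool
      pick c = if c then not (onArm A x) else onArm A y
    ... | tri≈ _ y≡x _ = ⊥-elim (x≢y (sym y≡x))
    ... | tri> _ _ x<y = trans (proj₁ (vKey-<ᵇ-< x<y)) (cong pick (sym (<ᵇ-false (ℕₚ.<-asym x<y))))
      where
      pick : Bool → Bool
      pick c = if c then not (onArm A x) else onArm A y

    invOneMinusOne-vPerm : invOneMinusOne vPerm ≡ ∣ A ∣
    invOneMinusOne-vPerm =
      trans (firstIndex-unique (λ p → vPerm p == zero) (==⁺ (vPerm∘vPerm⁻¹ zero)) unique) toℕ-vPerm⁻¹-zero
      where
      unique : ∀ p → T (vPerm p == zero) → p ≡ vPerm⁻¹ zero
      unique p h = trans (sym (vPerm⁻¹∘vPerm p)) (cong vPerm⁻¹ (==⁻ h))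

    isVPerm-vPerm : T (isVPerm vPerm)
    isVPerm-vPerm = anyB-tabulate⁺ _ id turn (allB-tabulate⁺ _ id shape)
      where
      turn : Fin (suc m)
      turn = vPerm⁻¹ zero
      a b : Fin m → Fin (suc m)
      a i = vPerm (inject₁ i)
      b i = vPerm (suc i)
      keys : ∀ i → (vKey (a i) Nat.<ᵇ vKey (b i)) ≡ true
      keys i = <ᵇ-true (vPerm⁻¹-<-cancel {a i} {b i}
                 (subst₂ Fin._<_ (sym (vPerm⁻¹∘vPerm _)) (sym (vPerm⁻¹∘vPerm _))
                         (Finₚ.≤̄⇒inject₁< ℕₚ.≤-refl)))
      shape : ∀ i → T (if toℕ i Nat.<ᵇ toℕ turn then isDescent vPerm i else (a i <ᵇ b i))
      shape i with toℕ i Nat.<ᵇ toℕ turn | ℕₚ.<ᵇ-reflects-< (toℕ i) (toℕ turn) | Finₚ.<-cmp (a i) (b i)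
      ... | _     | _       | tri≈ _ a≡b _ = ⊥-elim (inject₁≢suc i (vPerm-injective a≡b))
      ... | true  | ofʸ _   | tri> _ _ b<a = ℕₚ.<⇒<ᵇ b<a
      ... | false | ofⁿ _   | tri< a<b _ _ = ℕₚ.<⇒<ᵇ a<b
      ... | true  | ofʸ i<t | tri< a<b _ _ = ⊥-elim (T-not⇒¬T b-off b-on)
        where
        b-off : T (not (onArm A (b i)))
        b-off = subst T (trans (sym (keys i)) (proj₂ (vKey-<ᵇ-< a<b))) _
        b-on : T (onArm A (b i))
        b-on = vPerm⁻¹≤⇒onArm {b i} (subst (Fin._≤ turn) (sym (vPerm⁻¹∘vPerm (suc i))) i<t)
      ... | false | ofⁿ i≮t | tri> _ _ b<a = ⊥-elim (ℕₚ.n≮0 (subst (λ x → toℕ (b i) < toℕ x) a≡0 b<a))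
        where
        a-on : T (onArm A (a i))
        a-on = subst T (trans (sym (keys i)) (proj₁ (vKey-<ᵇ-< b<a))) _
        i≤t : toℕ (inject₁ i) ≤ toℕ turn
        i≤t = subst (Fin._≤ turn) (vPerm⁻¹∘vPerm (inject₁ i)) (onArm⇒vPerm⁻¹≤ {a i} a-on)
        t≤i : toℕ turn ≤ toℕ (inject₁ i)
        t≤i = subst (toℕ turn ≤_) (sym (Finₚ.toℕ-inject₁ i)) (ℕₚ.≮⇒≥ i≮t)
        a≡0 : a i ≡ zero
        a≡0 = trans (cong vPerm (Finₚ.toℕ-injective (ℕₚ.≤-antisym i≤t t≤i))) (vPerm∘vPerm⁻¹ zero)

  vPerm-cancel : ∀ {m} (A B : Subset m) → vPerm A ≗ vPerm B → A ≡ B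
  vPerm-cancel A B A≗B = trans (sym (Vecₚ.tabulate∘lookup A))
                               (trans (Vecₚ.tabulate-cong lookup≗) (Vecₚ.tabulate∘lookup B))
    where
    vPerm⁻¹≗ : vPerm⁻¹ A ≗ vPerm⁻¹ B
    vPerm⁻¹≗ x = trans (sym (vPerm⁻¹∘vPerm B (vPerm⁻¹ A x)))
                       (cong (vPerm⁻¹ B) (trans (sym (A≗B (vPerm⁻¹ A x))) (vPerm∘vPerm⁻¹ A x)))
    lookup≗ : lookup A ≗ lookup B
    lookup≗ j = trans (lookup-vPerm⁻¹ A j)
                      (trans (cong₂ _<ᵇ_ (vPerm⁻¹≗ (suc j)) (vPerm⁻¹≗ zero)) (sym (lookup-vPerm⁻¹ B j)))

  isDescent-vPerm⁻¹∘ : ∀ {m} (A : Subset m) {π : Map (suc m)} → Injective _≡_ _≡_ π → ∀ i →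
                       isDescent (vPerm⁻¹ A ∘ π) i ≡
                       (if isDescent π i then not (onArm A (π (inject₁ i))) else onArm A (π (suc i)))
  isDescent-vPerm⁻¹∘ A {π} π-inj i =
    trans (vPerm⁻¹-<ᵇ A (π (suc i)) (π (inject₁ i))) (vKey-<ᵇ A (inject₁≢suc i ∘ π-inj))

  -- armSet collects the values that α places before 0; the keys of α's values then increase, which
  -- forces α = vPerm armSet.
  module VPermutation {m} {α : Map (suc m)} (α-inj : Injective _≡_ _≡_ α) (α-V : T (isVPerm α)) where

    private
      shapeIf : Bool → Fin m → Bool
      shapeIf c i = if c then isDescent α i else (α (inject₁ i) <ᵇ α (suc i))

      turning : ∃ λ k → T (allB (λ i → shapeIf (toℕ i Nat.<ᵇ toℕ k) i) (allFin m))
      turning = anyB-tabulate⁻ (λ k → allB (λ i → shapeIf (toℕ i Nat.<ᵇ toℕ k) i) (allFin m))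
                               {suc m} id α-V

    turn : Fin (suc m)
    turn = proj₁ turning

    private
      shape : ∀ i → T (shapeIf (toℕ i Nat.<ᵇ toℕ turn) i)
      shape = allB-tabulate⁻ (λ i → shapeIf (toℕ i Nat.<ᵇ toℕ turn) i) {m} id (proj₂ turning)

    descends : ∀ i → toℕ i < toℕ turn → α (suc i) Fin.< α (inject₁ i)
    descends i i<t = ℕₚ.<ᵇ⇒< _ _ (subst (λ c → T (shapeIf c i)) (<ᵇ-true i<t) (shape i))

    ascends : ∀ i → ¬ toℕ i < toℕ turn → α (inject₁ i) Fin.< α (suc i)
    ascends i i≮t = ℕₚ.<ᵇ⇒< _ _ (subst (λ c → T (shapeIf c i)) (<ᵇ-false i≮t) (shape i))

    zero-at-turn : ∀ z → α z ≡ zero → z ≡ turn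
    zero-at-turn z αz≡0 with Finₚ.<-cmp z turn
    ... | tri≈ _ z≡t _ = z≡t
    ... | tri< z<t _ _ = ⊥-elim (ℕₚ.n≮0 (subst (λ x → toℕ (α (suc i)) < toℕ x) αi≡0 (descends i i<t)))
      where
      m≢z : m ≢ toℕ z
      m≢z m≡z = ℕₚ.<⇒≱ z<t (subst (toℕ turn ≤_) m≡z (Finₚ.toℕ≤pred[n] turn))
      i : Fin m
      i = Fin.lower₁ z m≢z
      αi≡0 : α (inject₁ i) ≡ zero
      αi≡0 = trans (cong α (Finₚ.inject₁-lower₁ z m≢z)) αz≡0
      i<t : toℕ i < toℕ turn
      i<t = subst (_< toℕ turn) (sym (Finₚ.toℕ-lower₁ z m≢z)) z<t
    zero-at-turn zero    _    | tri> _ _ ()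
    zero-at-turn (suc i) αz≡0 | tri> _ _ t<z =
      ⊥-elim (ℕₚ.n≮0 (subst (λ x → toℕ (α (inject₁ i)) < toℕ x) αz≡0
                            (ascends i (ℕₚ.≤⇒≯ (Nat.s≤s⁻¹ t<z)))))

    α-turn : α turn ≡ zero
    α-turn = trans (cong α (sym (zero-at-turn _ (inverseʳ α-inj zero)))) (inverseʳ α-inj zero)

    armSet : Subset m
    armSet = tabulate (λ j → inverse α-inj (suc j) <ᵇ turn)

    onArm-armSet : ∀ p → onArm armSet (α p) ≡ (toℕ p Nat.<ᵇ suc (toℕ turn))
    onArm-armSet p with α p in αp
    ... | zero  =
      sym (<ᵇ-true (subst (λ x → toℕ x < suc (toℕ turn)) (sym (zero-at-turn p αp)) (ℕₚ.n<1+n _)))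
    ... | suc j = trans (Vecₚ.lookup∘tabulate _ j)
                        (trans (cong (_<ᵇ turn) (trans (cong (inverse α-inj) (sym αp)) (inverseˡ α-inj p)))
                               (<ᵇ-≢-suc p≢t))
      where
      p≢t : toℕ p ≢ toℕ turn
      p≢t e with () ← trans (sym αp) (trans (cong α (Finₚ.toℕ-injective e)) α-turn)

    vKey-armSet-ascending : ∀ i → vKey armSet (α (inject₁ i)) < vKey armSet (α (suc i))
    vKey-armSet-ascending i with toℕ i ℕₚ.<? toℕ turn
    ... | yes i<t = ℕₚ.<ᵇ⇒< _ _ (Equivalence.from T-≡
        (trans (proj₁ (vKey-<ᵇ-< armSet (descends i i<t)))
               (trans (onArm-armSet (inject₁ i))
                      (<ᵇ-true (subst (_< suc (toℕ turn)) (sym (Finₚ.toℕ-inject₁ i)) (ℕₚ.m<n⇒m<1+n i<t))))))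
    ... | no i≮t = ℕₚ.<ᵇ⇒< _ _ (Equivalence.from T-≡
        (trans (proj₂ (vKey-<ᵇ-< armSet (ascends i i≮t)))
               (cong not (trans (onArm-armSet (suc i)) (<ᵇ-false i≮t)))))

    ≗vPerm-armSet : α ≗ vPerm armSet
    ≗vPerm-armSet p = trans (sym (vPerm∘vPerm⁻¹ armSet (α p))) (cong (vPerm armSet) (positions p))
      where
      positions : vPerm⁻¹ armSet ∘ α ≗ id
      positions = ascending⇒≗id (vPerm⁻¹ armSet ∘ α)
                    (λ i → vPerm⁻¹-mono-< armSet {α (inject₁ i)} {α (suc i)} (vKey-armSet-ascending i))

  isVPerm⇒≗vPerm : ∀ {m} {α : Map (suc m)} → Injective _≡_ _≡_ α → T (isVPerm α) →
                   ∃ λ A → α ≗ vPerm A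
  isVPerm⇒≗vPerm α-inj α-V = armSet , ≗vPerm-armSet
    where open VPermutation α-inj α-V

module _ where
  open ≡ using (refl; sym; trans; cong)

  -- Pairs of adjacent positions are indexed by Fin k and positions by Fin (suc k); at position p,
  -- pairBefore reads the pair (p − 1, p) and pairAfter the pair (p, p + 1), with a default at the ends.
  pairBefore : ∀ {k} → Bool → (Fin k → Bool) → Fin (suc k) → Bool
  pairBefore l g zero    = l
  pairBefore l g (suc i) = g i

  pairBefore-suc : ∀ {k} l (g : Fin (suc k) → Bool) p → pairBefore l g (suc p) ≡ pairBefore (g zero) (g ∘ suc) p
  pairBefore-suc l g zero    = refl
  pairBefore-suc l g (suc p) = refl

  pairAfter : ∀ {k} → (Fin k → Bool) → Fin (suc k) → Bool
  pairAfter {zero}  g zero    = false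
  pairAfter {suc k} g zero    = g zero
  pairAfter {suc k} g (suc p) = pairAfter (g ∘ suc) p

  pairAfter-inject₁ : ∀ {k} (g : Fin k → Bool) i → pairAfter g (inject₁ i) ≡ g i
  pairAfter-inject₁ {suc k} g zero    = refl
  pairAfter-inject₁ {suc k} g (suc i) = pairAfter-inject₁ (g ∘ suc) i

  pairAfter-last : ∀ {k} (g : Fin k → Bool) → pairAfter g (Fin.fromℕ k) ≡ false
  pairAfter-last {zero}  g = refl
  pairAfter-last {suc k} g = pairAfter-last (g ∘ suc)

  pairAfter-false : ∀ {k} (g : Fin k → Bool) p → (∀ i → inject₁ i ≡ p → g i ≡ false) →
                    pairAfter g p ≡ false
  pairAfter-false {zero}  g zero    _ = refl
  pairAfter-false {suc k} g zero    h = h zero refl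
  pairAfter-false {suc k} g (suc p) h = pairAfter-false (g ∘ suc) p (λ i → h (suc i) ∘ cong suc)

  descent-split : ∀ d i a b → not (if d then not a else b) ∨ i ≡
                              (not (not i ∧ d) ∨ a) ∧ (not (not i ∧ not d) ∨ not b)
  descent-split true  true  true  _     = refl
  descent-split true  true  false _     = refl
  descent-split true  false true  _     = refl
  descent-split true  false false _     = refl
  descent-split false true  _     true  = refl
  descent-split false true  _     false = refl
  descent-split false false _     true  = refl
  descent-split false false _     false = refl

  ascentOutside descentOutside : ∀ {k} → Subset k → Subset k → Fin k → Bool
  ascentOutside  I D i = not (lookup I i) ∧ not (lookup D i)
  descentOutside I D i = not (lookup I i) ∧ lookup D i

module _ where
  open ≡ using (refl; sym; trans; cong)
  open import Data.Nat using (_+_; _<_; _≤_)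

  -- overline K I for I ⊆ K, computed along the vectors; v is the length so far of the current part of
  -- comp(K).
  blockEnds : ∀ {k} → Subset k → Subset k → ℕ → List ℕ
  blockEnds []          []          v = v ∷ []
  blockEnds (true  ∷ I) (_     ∷ K) v = v ∷ blockEnds I K 1
  blockEnds (false ∷ I) (true  ∷ K) v = blockEnds I K 1
  blockEnds (false ∷ I) (false ∷ K) v = blockEnds I K (suc v)

  compAux-head : ∀ {k} (I : Subset k) c → ∃ λ t → ∃ λ ts → compAux I c ≡ t ∷ ts × c ≤ t
  compAux-head []          c = c , [] , refl , ℕₚ.≤-refl
  compAux-head (true  ∷ I) c = c , compAux I 1 , refl , ℕₚ.≤-refl
  compAux-head (false ∷ I) c = let t , ts , e , c+1≤t = compAux-head I (suc c) in t , ts , e , ℕₚ.<⇒≤ c+1≤t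

  ≡ᵇ-refl : ∀ u → (u Nat.≡ᵇ u) ≡ true
  ≡ᵇ-refl u = Equivalence.to T-≡ (ℕₚ.≡⇒≡ᵇ u u refl)

  <⇒≡ᵇ-false : ∀ {u v} → u < v → (u Nat.≡ᵇ v) ≡ false
  <⇒≡ᵇ-false u<v = T-injective (λ h → ⊥-elim (ℕₚ.<-irrefl (ℕₚ.≡ᵇ⇒≡ _ _ h) u<v)) (λ ())

  blockLasts-skip : ∀ {k} (I : Subset k) c ps acc p → acc + p < c →
                    blockLasts (compAux I c) (p ∷ ps) acc ≡ blockLasts (compAux I c) ps (acc + p)
  blockLasts-skip I c ps acc p lt with compAux-head I c
  ... | t , ts , e , c≤t rewrite e | <⇒≡ᵇ-false (ℕₚ.<-≤-trans lt c≤t) = refl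

  blockLasts-compAux : ∀ {k} (I K : Subset k) c d acc → c ≡ acc + d → I ⊆ K →
                       blockLasts (compAux I c) (compAux K d) acc ≡ blockEnds I K d
  blockLasts-compAux []          []          c d acc refl _   rewrite ≡ᵇ-refl (acc + d) = refl
  blockLasts-compAux (true  ∷ I) (true  ∷ K) c d acc refl I⊆K rewrite ≡ᵇ-refl (acc + d) =
    cong (d ∷_) (blockLasts-compAux I K 1 1 0 refl (drop-∷-⊆ I⊆K))
  blockLasts-compAux (true  ∷ I) (false ∷ K) c d acc _    I⊆K with () ← I⊆K here
  blockLasts-compAux (false ∷ I) (true  ∷ K) c d acc refl I⊆K =
    trans (blockLasts-skip I (suc (acc + d)) (compAux K 1) acc d ℕₚ.≤-refl)
          (blockLasts-compAux I K (suc (acc + d)) 1 (acc + d) (ℕₚ.+-comm 1 (acc + d)) (drop-∷-⊆ I⊆K))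
  blockLasts-compAux (false ∷ I) (false ∷ K) c d acc refl I⊆K =
    blockLasts-compAux I K (suc (acc + d)) (suc d) acc (sym (ℕₚ.+-suc acc d)) (drop-∷-⊆ I⊆K)

  overline≡blockEnds : ∀ {k} {I K : Subset k} → I ⊆ K → overline K I ≡ blockEnds I K 1
  overline≡blockEnds {I = I} {K} = blockLasts-compAux I K 1 1 0 refl

module FiniteSums {c ℓ} (R : CommutativeRing c ℓ) where
  open CommutativeRing R hiding (zero)
  open Alg R
  open import Relation.Binary.Reasoning.Setoid setoid
  open import Algebra.Properties.CommutativeMonoid.Sum +-commutativeMonoid public
    using (sum; sum-cong-≋; sum-replicate-zero)
  open import Algebra.Properties.CommutativeMonoid.Sum *-commutativeMonoid public
    using () renaming (sum to ∏; sum-cong-≋ to ∏-cong; ∑-permute to ∏-permute; ∑-distrib-+ to ∏-distrib-*;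
                       sum-init-last to ∏-init-last; sum-remove to ∏-remove)
  open import Algebra.Properties.CommutativeSemigroup *-commutativeSemigroup public
    using () renaming (x∙yz≈y∙xz to x*[y*z]≈y*[x*z])
  open import Algebra.Properties.CommutativeSemigroup +-commutativeSemigroup
    using () renaming (x∙yz≈y∙xz to x+[y+z]≈y+[x+z])

  Σ[_] : ∀ {a} {A : Set a} → List A → (A → Carrier) → Carrier
  Σ[ xs ] f = sumL (List.map f xs)

  [1or0]-∧ : ∀ a b → [1or0] (a ∧ b) ≈ [1or0] a * [1or0] b
  [1or0]-∧ true  b = sym (*-identityˡ _)
  [1or0]-∧ false b = sym (zeroˡ _)

  module _ {a} {A : Set a} where

    Σ-cong : ∀ xs {f g : A → Carrier} → (∀ x → f x ≈ g x) → Σ[ xs ] f ≈ Σ[ xs ] g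
    Σ-cong []       f≈g = refl
    Σ-cong (x ∷ xs) f≈g = +-cong (f≈g x) (Σ-cong xs f≈g)

    Σ-zero : ∀ xs {f : A → Carrier} → (∀ x → f x ≈ 0#) → Σ[ xs ] f ≈ 0#
    Σ-zero []       f≈0 = refl
    Σ-zero (x ∷ xs) f≈0 = trans (+-cong (f≈0 x) (Σ-zero xs f≈0)) (+-identityˡ 0#)

    Σ-++ : ∀ xs ys (f : A → Carrier) → Σ[ xs ++ ys ] f ≈ Σ[ xs ] f + Σ[ ys ] f
    Σ-++ []       ys f = sym (+-identityˡ _)
    Σ-++ (x ∷ xs) ys f = trans (+-congˡ (Σ-++ xs ys f)) (sym (+-assoc _ _ _))

    Σ-*ˡ : ∀ xs k (f : A → Carrier) → Σ[ xs ] (λ x → k * f x) ≈ k * Σ[ xs ] f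
    Σ-*ˡ []       k f = sym (zeroʳ k)
    Σ-*ˡ (x ∷ xs) k f = trans (+-congˡ (Σ-*ˡ xs k f)) (sym (distribˡ k _ _))

    Σ-*ʳ : ∀ xs k (f : A → Carrier) → Σ[ xs ] (λ x → f x * k) ≈ Σ[ xs ] f * k
    Σ-*ʳ xs k f = trans (Σ-cong xs (λ x → *-comm (f x) k)) (trans (Σ-*ˡ xs k f) (*-comm k _))

    Σ-+ : ∀ xs (f g : A → Carrier) → Σ[ xs ] (λ x → f x + g x) ≈ Σ[ xs ] f + Σ[ xs ] g
    Σ-+ []       f g = sym (+-identityˡ 0#)
    Σ-+ (x ∷ xs) f g = begin
      (f x + g x) + Σ[ xs ] (λ x → f x + g x) ≈⟨ +-congˡ (Σ-+ xs f g) ⟩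
      (f x + g x) + (Σ[ xs ] f + Σ[ xs ] g)   ≈⟨ +-assoc _ _ _ ⟩
      f x + (g x + (Σ[ xs ] f + Σ[ xs ] g))   ≈⟨ +-congˡ (x+[y+z]≈y+[x+z] _ _ _) ⟩
      f x + (Σ[ xs ] f + (g x + Σ[ xs ] g))   ≈⟨ +-assoc _ _ _ ⟨
      (f x + Σ[ xs ] f) + (g x + Σ[ xs ] g)   ∎

    Σ-filter : ∀ xs (p : A → Bool) (f : A → Carrier) →
               Σ[ List.filter (λ x → p x Bool.≟ true) xs ] f ≈ Σ[ xs ] (λ x → [1or0] (p x) * f x)
    Σ-filter []       p f = refl
    Σ-filter (x ∷ xs) p f with p x
    ... | true  = +-cong (sym (*-identityˡ _)) (Σ-filter xs p f)
    ... | false = trans (Σ-filter xs p f) (sym (trans (+-congʳ (zeroˡ _)) (+-identityˡ _)))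

    Σ-tabulate : ∀ {n} (g : Fin n → A) (f : A → Carrier) → Σ[ List.tabulate g ] f ≡ sum (f ∘ g)
    Σ-tabulate {zero}  g f = ≡.refl
    Σ-tabulate {suc n} g f = ≡.cong (f (g zero) +_) (Σ-tabulate (g ∘ suc) f)

  module _ {a b} {A : Set a} {B : Set b} where

    Σ-map : ∀ xs (g : A → B) (f : B → Carrier) → Σ[ List.map g xs ] f ≡ Σ[ xs ] (f ∘ g)
    Σ-map []       g f = ≡.refl
    Σ-map (x ∷ xs) g f = ≡.cong (f (g x) +_) (Σ-map xs g f)

    Σ-concatMap : ∀ xs (g : A → List B) (f : B → Carrier) →
                  Σ[ concatMap g xs ] f ≈ Σ[ xs ] (λ x → Σ[ g x ] f)
    Σ-concatMap []       g f = refl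
    Σ-concatMap (x ∷ xs) g f = trans (Σ-++ (g x) (concatMap g xs) f) (+-congˡ (Σ-concatMap xs g f))

    Σ-comm : ∀ xs ys (f : A → B → Carrier) →
             Σ[ xs ] (λ x → Σ[ ys ] (f x)) ≈ Σ[ ys ] (λ y → Σ[ xs ] (λ x → f x y))
    Σ-comm []       ys f = sym (Σ-zero ys (λ _ → refl))
    Σ-comm (x ∷ xs) ys f = trans (+-congˡ (Σ-comm xs ys f)) (sym (Σ-+ ys (f x) _))

  [1or0]-allB : ∀ {a} {A : Set a} (p : A → Bool) {n} (g : Fin n → A) →
                [1or0] (allB p (List.tabulate g)) ≈ ∏ (λ i → [1or0] (p (g i)))
  [1or0]-allB p {zero}  g = refl
  [1or0]-allB p {suc n} g = trans ([1or0]-∧ (p (g zero)) _) (*-congˡ ([1or0]-allB p (g ∘ suc)))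

  ^-∣∣ : ∀ x {k} (A : Subset k) → x ^ ∣ A ∣ ≈ ∏ (λ j → if lookup A j then x else 1#)
  ^-∣∣ x []          = refl
  ^-∣∣ x (true  ∷ A) = *-congˡ (^-∣∣ x A)
  ^-∣∣ x (false ∷ A) = trans (^-∣∣ x A) (sym (*-identityˡ _))

  [1or0]-T : ∀ {b} → T b → [1or0] b ≡ 1#
  [1or0]-T {true} _ = ≡.refl

  δ-sum : ∀ {n} (t : Fin n) (h : Fin n → Carrier) → sum (λ x → [1or0] (does (x Finₚ.≟ t)) * h x) ≈ h t
  δ-sum {suc n} zero    h = trans (+-cong (*-identityˡ _) rest≈0) (+-identityʳ _)
    where
    rest≈0 : sum (λ x → 0# * h (suc x)) ≈ 0#
    rest≈0 = trans (sum-cong-≋ (λ x → zeroˡ (h (suc x)))) (sum-replicate-zero n)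
  δ-sum {suc n} (suc t) h = trans (+-cong (zeroˡ _) (δ-sum t (h ∘ suc))) (+-identityˡ _)

  δ-allFin : ∀ {n} (t : Fin n) (h : Fin n → Carrier) →
             Σ[ allFin n ] (λ x → [1or0] (does (x Finₚ.≟ t)) * h x) ≈ h t
  δ-allFin {n} t h = trans (reflexive (Σ-tabulate {n = n} id _)) (δ-sum t h)

  δ-Bool : ∀ t (h : Bool → Carrier) →
           Σ[ inside ∷ outside ∷ [] ] (λ x → [1or0] (does (x Bool.≟ t)) * h x) ≈ h t
  δ-Bool true  h = trans (+-cong (*-identityˡ _) (trans (+-congʳ (zeroˡ _)) (+-identityˡ _))) (+-identityʳ _)
  δ-Bool false h = trans (+-cong (zeroˡ _) (+-congʳ (*-identityˡ _))) (trans (+-identityˡ _) (+-identityʳ _))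

  module _ {a} {A : Set a} (xs : List A) where

    Σ-allVecs-suc : ∀ k (f : Vec A (suc k) → Carrier) →
                    Σ[ allVecs xs (suc k) ] f ≈ Σ[ xs ] (λ x → Σ[ allVecs xs k ] (f ∘ (x ∷_)))
    Σ-allVecs-suc k f =
      trans (Σ-concatMap xs _ f) (Σ-cong xs (λ x → reflexive (Σ-map (allVecs xs k) (x ∷_) f)))

    Σ-allVecs-∏ : ∀ k (w : Fin k → A → Carrier) →
                  Σ[ allVecs xs k ] (λ v → ∏ (λ j → w j (lookup v j))) ≈ ∏ (λ j → Σ[ xs ] (w j))
    Σ-allVecs-∏ zero    w = +-identityʳ 1#
    Σ-allVecs-∏ (suc k) w = begin
      Σ[ allVecs xs (suc k) ] (λ v → ∏ (λ j → w j (lookup v j)))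
        ≈⟨ Σ-allVecs-suc k _ ⟩
      Σ[ xs ] (λ x → Σ[ allVecs xs k ] (λ v → w zero x * ∏ (λ j → w (suc j) (lookup v j))))
        ≈⟨ Σ-cong xs (λ x → Σ-*ˡ (allVecs xs k) (w zero x) _) ⟩
      Σ[ xs ] (λ x → w zero x * Σ[ allVecs xs k ] (λ v → ∏ (λ j → w (suc j) (lookup v j))))
        ≈⟨ Σ-cong xs (λ x → *-congˡ (Σ-allVecs-∏ k (w ∘ suc))) ⟩
      Σ[ xs ] (λ x → w zero x * ∏ (λ j → Σ[ xs ] (w (suc j))))
        ≈⟨ Σ-*ʳ xs _ (w zero) ⟩
      Σ[ xs ] (w zero) * ∏ (λ j → Σ[ xs ] (w (suc j)))
        ∎

    module _ (_≟_ : DecidableEquality A)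
             (δ-xs : ∀ t (h : A → Carrier) → Σ[ xs ] (λ x → [1or0] (does (x ≟ t)) * h x) ≈ h t) where

      private
        _≟ᵥ_ : ∀ {k} → DecidableEquality (Vec A k)
        _≟ᵥ_ = Vecₚ.≡-dec _≟_

      δ-allVecs : ∀ {k} (t : Vec A k) (h : Vec A k → Carrier) →
                  Σ[ allVecs xs k ] (λ v → [1or0] (does (Vecₚ.≡-dec _≟_ v t)) * h v) ≈ h t
      δ-allVecs []       h = trans (+-identityʳ _) (*-identityˡ _)
      δ-allVecs {suc k} (t ∷ ts) h = begin
        Σ[ allVecs xs (suc k) ] (λ v → [1or0] (does (v ≟ᵥ (t ∷ ts))) * h v)
          ≈⟨ Σ-allVecs-suc k _ ⟩
        Σ[ xs ] (λ x → Σ[ allVecs xs k ] (λ v → [1or0] (does (x ≟ t) ∧ does (v ≟ᵥ ts)) * h (x ∷ v)))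
          ≈⟨ Σ-cong xs (λ x → trans (Σ-cong (allVecs xs k) (λ v → split x v)) (Σ-*ˡ (allVecs xs k) _ _)) ⟩
        Σ[ xs ] (λ x → [1or0] (does (x ≟ t)) * Σ[ allVecs xs k ] (λ v → [1or0] (does (v ≟ᵥ ts)) * h (x ∷ v)))
          ≈⟨ Σ-cong xs (λ x → *-congˡ (δ-allVecs ts (h ∘ (x ∷_)))) ⟩
        Σ[ xs ] (λ x → [1or0] (does (x ≟ t)) * h (x ∷ ts))
          ≈⟨ δ-xs t (λ x → h (x ∷ ts)) ⟩
        h (t ∷ ts)
          ∎
        where
        split : ∀ x v → [1or0] (does (x ≟ t) ∧ does (v ≟ᵥ ts)) * h (x ∷ v) ≈
                        [1or0] (does (x ≟ t)) * ([1or0] (does (v ≟ᵥ ts)) * h (x ∷ v))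
        split x v = trans (*-congʳ ([1or0]-∧ (does (x ≟ t)) _)) (*-assoc _ _ _)

  Σ-Sym-δ : ∀ {n} (f : Map n) → Injective _≡_ _≡_ f → (g : Map n → Carrier) →
            (∀ {α β} → α ≗ β → g α ≈ g β) →
            Σ[ Sym n ] (λ β → [1or0] (eqMap β f) * g β) ≈ g f
  Σ-Sym-δ {n} f inj g g-cong = begin
    Σ[ Sym n ] (λ β → [1or0] (eqMap β f) * g β)
      ≈⟨ Σ-filter (List.map lookup tables) isInjective _ ⟩
    Σ[ List.map lookup tables ] (λ β → [1or0] (isInjective β) * ([1or0] (eqMap β f) * g β))
      ≡⟨ Σ-map tables lookup _ ⟩
    Σ[ tables ] (λ v → [1or0] (isInjective (lookup v)) * ([1or0] (eqMap (lookup v) f) * g (lookup v)))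
      ≈⟨ Σ-cong tables (λ v → trans (x*[y*z]≈y*[x*z] _ _ _)
                                    (*-congʳ (reflexive (≡.cong [1or0] (eqMap-lookup v))))) ⟩
    Σ[ tables ] (λ v → [1or0] (does (v ≟ᵥ tabulate f)) * ([1or0] (isInjective (lookup v)) * g (lookup v)))
      ≈⟨ δ-allVecs (allFin n) Finₚ._≟_ δ-allFin (tabulate f) _ ⟩
    [1or0] (isInjective (lookup (tabulate f))) * g (lookup (tabulate f))
      ≈⟨ *-cong (reflexive ([1or0]-T (isInjective⁺ (inj ∘ lookup-tabulate-injective))))
                (g-cong (Vecₚ.lookup∘tabulate f)) ⟩
    1# * g f
      ≈⟨ *-identityˡ _ ⟩
    g f ∎
    where
    tables : List (Vec (Fin n) n)
    tables = allVecs (allFin n) n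
    _≟ᵥ_ : DecidableEquality (Vec (Fin n) n)
    _≟ᵥ_ = Vecₚ.≡-dec Finₚ._≟_
    lookup-tabulate-injective : ∀ {i j} → lookup (tabulate f) i ≡ lookup (tabulate f) j → f i ≡ f j
    lookup-tabulate-injective {i} {j} e =
      ≡.trans (≡.sym (Vecₚ.lookup∘tabulate f i)) (≡.trans e (Vecₚ.lookup∘tabulate f j))
    eqMap-lookup : ∀ v → eqMap (lookup v) f ≡ does (v ≟ᵥ tabulate f)
    eqMap-lookup v = T-≡-does (v ≟ᵥ tabulate f)
      (λ h → ≡.trans (≡.sym (Vecₚ.tabulate∘lookup v)) (Vecₚ.tabulate-cong (eqMap⁻ h)))
      (λ v≡f → eqMap⁺ (λ i → ≡.trans (≡.cong (λ u → lookup u i) v≡f) (Vecₚ.lookup∘tabulate f i)))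

module VExpansion {c ℓ} (R : CommutativeRing c ℓ) where
  open CommutativeRing R hiding (zero)
  open Alg R
  open FiniteSums R
  open import Relation.Binary.Reasoning.Setoid setoid

  [isVPerm]≈Σ : ∀ {m} {β : Map (suc m)} → Injective _≡_ _≡_ β → (h : Carrier) →
                [1or0] (isVPerm β) * h ≈ Σ[ allSubsets m ] (λ A → [1or0] (eqMap β (vPerm A)) * h)
  [isVPerm]≈Σ {m} {β} β-inj h with isVPerm β in isV
  ... | true  = begin
    1# * h
      ≈⟨ *-identityˡ h ⟩
    h
      ≈⟨ δ-allVecs (inside ∷ outside ∷ []) Bool._≟_ δ-Bool A₀ (λ _ → h) ⟨
    Σ[ allSubsets m ] (λ A → [1or0] (does (Vecₚ.≡-dec Bool._≟_ A A₀)) * h)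
      ≈⟨ Σ-cong (allSubsets m) (λ A → *-congʳ (reflexive (≡.cong [1or0] (same A)))) ⟨
    Σ[ allSubsets m ] (λ A → [1or0] (eqMap β (vPerm A)) * h) ∎
    where
    β-shape : ∃ λ A → β ≗ vPerm A
    β-shape = isVPerm⇒≗vPerm β-inj (Equivalence.from T-≡ isV)
    A₀ : Subset m
    A₀ = proj₁ β-shape
    same : ∀ A → eqMap β (vPerm A) ≡ does (Vecₚ.≡-dec Bool._≟_ A A₀)
    same A = T-≡-does (Vecₚ.≡-dec Bool._≟_ A A₀)
      (λ h → vPerm-cancel A A₀ (λ p → ≡.trans (≡.sym (eqMap⁻ h p)) (proj₂ β-shape p)))
      (λ { ≡.refl → eqMap⁺ (proj₂ β-shape) })
  ... | false = trans (zeroˡ h) (sym (Σ-zero (allSubsets m) λ A →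
                  trans (*-congʳ (reflexive (≡.cong [1or0] (not-V A)))) (zeroˡ h)))
    where
    not-V : ∀ A → eqMap β (vPerm A) ≡ false
    not-V A = T-injective (λ h → ≡.subst T isV (≡.subst T (≡.sym (isVPerm-cong {g = vPerm A} (eqMap⁻ h)))
                                                           (isVPerm-vPerm A)))
                          (λ ())

  Σ-Sym-isVPerm : ∀ {m} (H : Map (suc m) → Carrier) → (∀ {α β} → α ≗ β → H α ≈ H β) →
                  Σ[ Sym (suc m) ] (λ α → [1or0] (isVPerm α) * H α) ≈ Σ[ allSubsets m ] (H ∘ vPerm)
  Σ-Sym-isVPerm {m} H H-cong = begin
    Σ[ Sym n ] (λ α → [1or0] (isVPerm α) * H α)
      ≈⟨ Σ-filter maps isInjective _ ⟩
    Σ[ maps ] (λ α → [1or0] (isInjective α) * ([1or0] (isVPerm α) * H α))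
      ≈⟨ Σ-cong maps (λ α → trans (by-injectivity α) (sym (Σ-*ˡ (allSubsets m) _ _))) ⟩
    Σ[ maps ] (λ α → Σ[ allSubsets m ] (λ A → [1or0] (isInjective α) * ([1or0] (eqMap α (vPerm A)) * H α)))
      ≈⟨ Σ-comm maps (allSubsets m) _ ⟩
    Σ[ allSubsets m ] (λ A → Σ[ maps ] (λ α → [1or0] (isInjective α) * ([1or0] (eqMap α (vPerm A)) * H α)))
      ≈⟨ Σ-cong (allSubsets m) (λ A → sym (Σ-filter maps isInjective _)) ⟩
    Σ[ allSubsets m ] (λ A → Σ[ Sym n ] (λ α → [1or0] (eqMap α (vPerm A)) * H α))
      ≈⟨ Σ-cong (allSubsets m) (λ A → Σ-Sym-δ (vPerm A) (vPerm-injective A) H H-cong) ⟩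
    Σ[ allSubsets m ] (H ∘ vPerm) ∎
    where
    n : ℕ
    n = suc m
    maps : List (Map n)
    maps = List.map lookup (allVecs (allFin n) n)
    by-injectivity : ∀ α → [1or0] (isInjective α) * ([1or0] (isVPerm α) * H α) ≈
                           [1or0] (isInjective α) * Σ[ allSubsets m ] (λ A → [1or0] (eqMap α (vPerm A)) * H α)
    by-injectivity α with isInjective α in inj
    ... | true  = *-congˡ ([isVPerm]≈Σ (isInjective⁻ {f = α} (Equivalence.from T-≡ inj)) (H α))
    ... | false = trans (zeroˡ _) (sym (zeroˡ _))

  𝐕⋆-expansion : ∀ {m} (q : Carrier) (f : KS (suc m)) → (∀ {α β} → α ≗ β → f α ≈ f β) →
                 ∀ π → Injective _≡_ _≡_ π →
                 (𝐕 q ⋆ f) π ≈ Σ[ allSubsets m ] (λ A → (- q) ^ ∣ A ∣ * f (vPerm⁻¹ A ∘ π))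
  𝐕⋆-expansion {m} q f f-cong π π-inj = begin
    (𝐕 q ⋆ f) π
      ≈⟨ Σ-cong (Sym n) (λ α → trans (Σ-cong (Sym n) (λ β → regroup _ _ _ _))
                                     (trans (Σ-*ˡ (Sym n) _ _) (*-congˡ (Σ-*ˡ (Sym n) _ _)))) ⟩
    Σ[ Sym n ] (λ α → [1or0] (isVPerm α) * H α)
      ≈⟨ Σ-Sym-isVPerm H H-cong ⟩
    Σ[ allSubsets m ] (H ∘ vPerm)
      ≈⟨ Σ-cong (allSubsets m) (λ A → *-cong (reflexive (≡.cong ((- q) ^_) (invOneMinusOne-vPerm A)))
                                               (Σ-Sym-δ-vPerm A)) ⟩
    Σ[ allSubsets m ] (λ A → (- q) ^ ∣ A ∣ * f (vPerm⁻¹ A ∘ π)) ∎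
    where
    n : ℕ
    n = suc m
    H : Map n → Carrier
    H α = (- q) ^ invOneMinusOne α * Σ[ Sym n ] (λ β → [1or0] (eqMap (α ∘ₚ β) π) * f β)
    H-cong : ∀ {α α′} → α ≗ α′ → H α ≈ H α′
    H-cong α≗α′ =
      *-cong (reflexive (≡.cong ((- q) ^_) (invOneMinusOne-cong α≗α′)))
             (Σ-cong (Sym n) (λ β → *-congʳ (reflexive (≡.cong [1or0] (eqMap-congˡ π (α≗α′ ∘ β))))))
    regroup : ∀ e v x b → e * ((v * x) * b) ≈ v * (x * (e * b))
    regroup e v x b = trans (*-congˡ (*-assoc v x b))
                            (trans (x*[y*z]≈y*[x*z] e v (x * b)) (*-congˡ (x*[y*z]≈y*[x*z] e x b)))
    Σ-Sym-δ-vPerm : ∀ A → Σ[ Sym n ] (λ β → [1or0] (eqMap (vPerm A ∘ₚ β) π) * f β) ≈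
                          f (vPerm⁻¹ A ∘ π)
    Σ-Sym-δ-vPerm A = trans (Σ-cong (Sym n) (λ β → *-congʳ (reflexive (≡.cong [1or0] (moved β)))))
                            (Σ-Sym-δ (vPerm⁻¹ A ∘ π) (π-inj ∘ vPerm⁻¹-injective A) f f-cong)
      where
      moved : ∀ β → eqMap (vPerm A ∘ₚ β) π ≡ eqMap β (vPerm⁻¹ A ∘ π)
      moved β = T-injective
        (λ h → eqMap⁺ λ i → ≡.trans (≡.sym (vPerm⁻¹∘vPerm A (β i)))
                                    (≡.cong (vPerm⁻¹ A) (eqMap⁻ h i)))
        (λ h → eqMap⁺ λ i → ≡.trans (≡.cong (vPerm A) (eqMap⁻ h i)) (vPerm∘vPerm⁻¹ A (π i)))

module LocalFactors {c ℓ} (R : CommutativeRing c ℓ) (q : CommutativeRing.Carrier R) where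
  open CommutativeRing R hiding (zero)
  open Alg R
  open FiniteSums R
  open import Relation.Binary.Reasoning.Setoid setoid

  ψ : Bool → Bool → Carrier
  ψ l r = (- q) * [1or0] (not l) + [1or0] (not r)

  ψ-true-false : ψ true false ≈ 1#
  ψ-true-false = trans (+-congʳ (zeroʳ _)) (+-identityˡ _)

  ψ-false-false : ψ false false ≈ 1# - q
  ψ-false-false = trans (+-congʳ (*-identityʳ _)) (+-comm _ _)

  ψ-false-true : ψ false true ≈ - q
  ψ-false-true = trans (+-congʳ (*-identityʳ _)) (+-identityʳ _)

  ψ-true-true : ψ true true ≈ 0#
  ψ-true-true = trans (+-congʳ (zeroʳ _)) (+-identityʳ _)

  ψs : ∀ {k} → Bool → Subset k → Subset k → Fin (suc k) → Carrier
  ψs l I D p = ψ (pairBefore l (ascentOutside I D) p) (pairAfter (descentOutside I D) p)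

  ψs-suc : ∀ {k} l i d (I D : Subset k) p → ψs l (i ∷ I) (d ∷ D) (suc p) ≡ ψs (not i ∧ not d) I D p
  ψs-suc l i d I D p = ≡.cong (λ b → ψ b (pairAfter (descentOutside I D) p))
                              (pairBefore-suc l (ascentOutside (i ∷ I) (d ∷ D)) p)

  -- ∏ψs shows that α is the product of ψs with a left condition at the first position, and (1 − q) σ
  -- the one without.  So σ is that product with the factor 1 − q of a valley removed (∏ψs-removeAt),
  -- which in a general ring cannot be obtained by division.
  mutual
    σ : ∀ {k} → Subset k → Subset k → Carrier
    σ []          []          = 1#
    σ (true  ∷ I) (_     ∷ D) = (1# - q) * σ I D
    σ (false ∷ I) (true  ∷ D) = (- q) * σ I D
    σ (false ∷ I) (false ∷ D) = α I D

    α : ∀ {k} → Subset k → Subset k → Carrier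
    α []          []          = 1#
    α (true  ∷ I) (_     ∷ D) = (1# - q) * σ I D
    α (false ∷ I) (true  ∷ D) = 0#
    α (false ∷ I) (false ∷ D) = α I D

  ∏ψs : ∀ {k} l (I D : Subset k) → ∏ (ψs l I D) ≈ (if l then α I D else (1# - q) * σ I D)
  ∏ψs true  []          []          = trans (*-identityʳ _) ψ-true-false
  ∏ψs false []          []          = trans (*-identityʳ _) (trans ψ-false-false (sym (*-identityʳ _)))
  ∏ψs l     (i ∷ I)     (d ∷ D)     = trans (*-congˡ tail) (step l i d)
    where
    tail : ∏ (ψs l (i ∷ I) (d ∷ D) ∘ suc) ≈ (if not i ∧ not d then α I D else (1# - q) * σ I D)
    tail = trans (∏-cong (λ p → reflexive (ψs-suc l i d I D p))) (∏ψs (not i ∧ not d) I D)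
    step : ∀ l i d → ψ l (not i ∧ d) * (if not i ∧ not d then α I D else (1# - q) * σ I D) ≈
                     (if l then α (i ∷ I) (d ∷ D) else (1# - q) * σ (i ∷ I) (d ∷ D))
    step true  true  d     = trans (*-congʳ ψ-true-false) (*-identityˡ _)
    step false true  d     = *-congʳ ψ-false-false
    step true  false true  = trans (*-congʳ ψ-true-true) (zeroˡ _)
    step false false true  = trans (*-congʳ ψ-false-true) (x*[y*z]≈y*[x*z] _ _ _)
    step true  false false = trans (*-congʳ ψ-true-false) (*-identityˡ _)
    step false false false = *-congʳ ψ-false-false

  ∏ψs-removeAt : ∀ {k} (I D : Subset k) p →
                 pairBefore false (ascentOutside I D) p ≡ false → pairAfter (descentOutside I D) p ≡ false →
                 ∏ (removeAt (ψs false I D) p) ≈ σ I D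
  ∏ψs-removeAt []      []      zero    _ _  = refl
  ∏ψs-removeAt (i ∷ I) (d ∷ D) zero    _ R₀ =
    trans (∏-cong (λ p → reflexive (ψs-suc false i d I D p)))
          (trans (∏ψs (not i ∧ not d) I D) (at-valley i d R₀))
    where
    at-valley : ∀ i d → not i ∧ d ≡ false →
                (if not i ∧ not d then α I D else (1# - q) * σ I D) ≈ σ (i ∷ I) (d ∷ D)
    at-valley true  d     _ = refl
    at-valley false false _ = refl
  ∏ψs-removeAt (i ∷ I) (d ∷ D) (suc p) Lp Rp =
    trans (*-congˡ (∏-cong (λ j → reflexive (ψs-suc false i d I D (Fin.punchIn p j)))))
          (step i d (≡.trans (≡.sym (pairBefore-suc false (ascentOutside (i ∷ I) (d ∷ D)) p)) Lp))
    where
    step : ∀ i d → pairBefore (not i ∧ not d) (ascentOutside I D) p ≡ false →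
           ψ false (not i ∧ d) * ∏ (removeAt (ψs (not i ∧ not d) I D) p) ≈ σ (i ∷ I) (d ∷ D)
    step true  d     Lp′ = *-cong ψ-false-false (∏ψs-removeAt I D p Lp′ Rp)
    step false true  Lp′ = *-cong ψ-false-true (∏ψs-removeAt I D p Lp′ Rp)
    step false false Lp′ = begin
      ψ false false * ∏ (removeAt (ψs true I D) p)           ≈⟨ *-congʳ (trans ψ-false-false (sym ψ-at-p)) ⟩
      ψs true I D p * ∏ (removeAt (ψs true I D) p)            ≈⟨ ∏-remove (ψs true I D) ⟨
      ∏ (ψs true I D)                                          ≈⟨ ∏ψs true I D ⟩
      α I D                                                    ∎
      where
      ψ-at-p : ψs true I D p ≈ 1# - q
      ψ-at-p = trans (reflexive (≡.cong₂ ψ Lp′ Rp)) ψ-false-false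


module AtPermutation {c ℓ} (R : CommutativeRing c ℓ) (q : CommutativeRing.Carrier R)
                     {m} {π : Map (suc m)} (π-inj : Injective _≡_ _≡_ π) (I : Subset m) where
  open CommutativeRing R hiding (zero)
  open Alg R
  open FiniteSums R
  open VExpansion R
  open LocalFactors R q
  open import Relation.Binary.Reasoning.Setoid setoid

  descents : Subset m
  descents = tabulate (isDescent π)

  ascentBefore descentAfter : Fin (suc m) → Bool
  ascentBefore = pairBefore false (ascentOutside I descents)
  descentAfter = pairAfter (descentOutside I descents)

  allowed : Fin (suc m) → Bool → Bool
  allowed p c = (not (descentAfter p) ∨ c) ∧ (not (ascentBefore p) ∨ not c)

  valley : Fin (suc m)
  valley = inverse π-inj zero

  π-valley : π valley ≡ zero
  π-valley = inverseʳ π-inj zero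

  lookup-descents : ∀ i → lookup descents i ≡ isDescent π i
  lookup-descents = Vecₚ.lookup∘tabulate (isDescent π)

  ascentBefore-valley : ascentBefore valley ≡ false
  ascentBefore-valley = at valley π-valley
    where
    at : ∀ p → π p ≡ zero → ascentBefore p ≡ false
    at zero    _    = ≡.refl
    at (suc i) πp≡0 =
      ≡.trans (≡.cong (λ d → not (lookup I i) ∧ not d) (≡.trans (lookup-descents i) descent))
              (Boolₚ.∧-zeroʳ _)
      where
      πi≢0 : toℕ (π (inject₁ i)) ≢ 0
      πi≢0 e = inject₁≢suc i (π-inj (≡.trans (Finₚ.toℕ-injective e) (≡.sym πp≡0)))
      descent : isDescent π i ≡ true
      descent = <ᵇ-true (≡.subst (λ x → toℕ x Nat.< toℕ (π (inject₁ i))) (≡.sym πp≡0)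
                                 (ℕₚ.n≢0⇒n>0 πi≢0))

  descentAfter-valley : descentAfter valley ≡ false
  descentAfter-valley = pairAfter-false _ valley no-descent
    where
    no-descent : ∀ i → inject₁ i ≡ valley → descentOutside I descents i ≡ false
    no-descent i e =
      ≡.trans (≡.cong (not (lookup I i) ∧_) (≡.trans (lookup-descents i) into-zero)) (Boolₚ.∧-zeroʳ _)
      where
      into-zero : isDescent π i ≡ false
      into-zero = ≡.cong (λ x → toℕ (π (suc i)) Nat.<ᵇ toℕ x) (≡.trans (≡.cong π e) π-valley)

  𝐁-vPerm⁻¹∘ : ∀ A → 𝐁 I (vPerm⁻¹ A ∘ π) ≈ ∏ (λ p → [1or0] (allowed p (onArm A (π p))))
  𝐁-vPerm⁻¹∘ A = begin
    𝐁 I (vPerm⁻¹ A ∘ π)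
      ≈⟨ [1or0]-allB (λ i → not (isDescent (vPerm⁻¹ A ∘ π) i) ∨ lookup I i) id ⟩
    ∏ (λ i → [1or0] (not (isDescent (vPerm⁻¹ A ∘ π) i) ∨ lookup I i))
      ≈⟨ ∏-cong (λ i → trans (reflexive (≡.cong [1or0] (split i)))
                             ([1or0]-∧ (rightOK (inject₁ i)) (leftOK (suc i)))) ⟩
    ∏ (λ i → [1or0] (rightOK (inject₁ i)) * [1or0] (leftOK (suc i)))
      ≈⟨ ∏-distrib-* (λ i → [1or0] (rightOK (inject₁ i))) (λ i → [1or0] (leftOK (suc i))) ⟩
    ∏ (λ i → [1or0] (rightOK (inject₁ i))) * ∏ (λ i → [1or0] (leftOK (suc i)))
      ≈⟨ *-cong right-end (sym (*-identityˡ (∏ (λ i → [1or0] (leftOK (suc i)))))) ⟩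
    ∏ (λ p → [1or0] (rightOK p)) * ∏ (λ p → [1or0] (leftOK p))
      ≈⟨ ∏-distrib-* (λ p → [1or0] (rightOK p)) (λ p → [1or0] (leftOK p)) ⟨
    ∏ (λ p → [1or0] (rightOK p) * [1or0] (leftOK p))
      ≈⟨ ∏-cong (λ p → sym ([1or0]-∧ (rightOK p) (leftOK p))) ⟩
    ∏ (λ p → [1or0] (allowed p (onArm A (π p)))) ∎
    where
    rightOK leftOK : Fin (suc m) → Bool
    rightOK p = not (descentAfter p) ∨ onArm A (π p)
    leftOK  p = not (ascentBefore p) ∨ not (onArm A (π p))
    split : ∀ i → not (isDescent (vPerm⁻¹ A ∘ π) i) ∨ lookup I i ≡ rightOK (inject₁ i) ∧ leftOK (suc i)
    split i = ≡.trans (≡.cong (λ b → not b ∨ lookup I i) (isDescent-vPerm⁻¹∘ A π-inj i))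
              (≡.trans (descent-split (isDescent π i) (lookup I i) _ _)
                       (≡.sym (≡.cong₂ (λ r d → (not r ∨ onArm A (π (inject₁ i))) ∧
                                                 (not (not (lookup I i) ∧ not d) ∨ not (onArm A (π (suc i)))))
                                       (≡.trans (pairAfter-inject₁ _ i) (≡.cong (not (lookup I i) ∧_) dᵢ)) dᵢ)))
      where
      dᵢ : lookup descents i ≡ isDescent π i
      dᵢ = lookup-descents i
    right-end : ∏ (λ i → [1or0] (rightOK (inject₁ i))) ≈ ∏ (λ p → [1or0] (rightOK p))
    right-end = sym (trans (∏-init-last (λ p → [1or0] (rightOK p))) (trans (*-congˡ last-free) (*-identityʳ _)))
      where
      last-free : [1or0] (rightOK (Fin.fromℕ m)) ≈ 1#
      last-free = reflexive (≡.cong (λ r → [1or0] (not r ∨ onArm A (π (Fin.fromℕ m))))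
                                    (pairAfter-last (descentOutside I descents)))

  allowed-valley : allowed valley true ≡ true
  allowed-valley = ≡.cong₂ (λ r l → (not r ∨ true) ∧ (not l ∨ false)) descentAfter-valley ascentBefore-valley

  Σ-allowed : ∀ p → Σ[ inside ∷ outside ∷ [] ] (λ c → (if c then - q else 1#) * [1or0] (allowed p c)) ≈
                    ψs false I descents p
  Σ-allowed p = trans (+-cong (*-congˡ (reflexive (≡.cong [1or0] arm)))
                              (trans (+-identityʳ _) (trans (*-identityˡ _) (reflexive (≡.cong [1or0] off-arm)))))
                      refl
    where
    arm : allowed p true ≡ not (ascentBefore p)
    arm = ≡.cong₂ _∧_ (Boolₚ.∨-zeroʳ _) (Boolₚ.∨-identityʳ _)
    off-arm : allowed p false ≡ not (descentAfter p)
    off-arm = ≡.trans (≡.cong₂ _∧_ (Boolₚ.∨-identityʳ _) (Boolₚ.∨-zeroʳ _)) (Boolₚ.∧-identityʳ _)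

  π⁻¹ : Map (suc m)
  π⁻¹ = inverse π-inj

  allowed-by-value : ∀ A → ∏ (λ p → [1or0] (allowed p (onArm A (π p)))) ≈
                           ∏ (λ j → [1or0] (allowed (π⁻¹ (suc j)) (lookup A j)))
  allowed-by-value A = begin
    ∏ (λ p → [1or0] (allowed p (onArm A (π p))))
      ≈⟨ ∏-cong (λ p → reflexive (≡.cong (λ p′ → [1or0] (allowed p′ (onArm A (π p))))
                                         (≡.sym (inverseˡ π-inj p)))) ⟩
    ∏ (λ p → [1or0] (allowed (π⁻¹ (π p)) (onArm A (π p))))
      ≈⟨ ∏-permute (λ x → [1or0] (allowed (π⁻¹ x) (onArm A x))) (asPermutation π-inj) ⟨
    [1or0] (allowed valley true) * ∏ (λ j → [1or0] (allowed (π⁻¹ (suc j)) (lookup A j)))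
      ≈⟨ trans (*-congʳ (reflexive (≡.cong [1or0] allowed-valley))) (*-identityˡ _) ⟩
    ∏ (λ j → [1or0] (allowed (π⁻¹ (suc j)) (lookup A j))) ∎

  ψs-by-value : ∏ (λ j → ψs false I descents (π⁻¹ (suc j))) ≈ ∏ (removeAt (ψs false I descents) valley)
  ψs-by-value = begin
    ∏ (λ j → ψs false I descents (π⁻¹ (suc j)))
      ≈⟨ *-identityˡ _ ⟨
    ∏ W
      ≈⟨ ∏-permute W (asPermutation π-inj) ⟩
    ∏ (W ∘ π)
      ≈⟨ ∏-remove {i = valley} (W ∘ π) ⟩
    W (π valley) * ∏ (removeAt (W ∘ π) valley)
      ≈⟨ *-cong (reflexive (≡.cong W π-valley)) (∏-cong W∘π) ⟩
    1# * ∏ (removeAt (ψs false I descents) valley)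
      ≈⟨ *-identityˡ _ ⟩
    ∏ (removeAt (ψs false I descents) valley) ∎
    where
    W : Fin (suc m) → Carrier
    W zero    = 1#
    W (suc j) = ψs false I descents (π⁻¹ (suc j))
    W∘π : ∀ j → W (π (Fin.punchIn valley j)) ≈ ψs false I descents (Fin.punchIn valley j)
    W∘π j with π (Fin.punchIn valley j) in πp
    ... | zero  = ⊥-elim (Finₚ.punchInᵢ≢i valley j (π-inj (≡.trans πp (≡.sym π-valley))))
    ... | suc _ =
      reflexive (≡.cong (ψs false I descents) (≡.trans (≡.cong π⁻¹ (≡.sym πp)) (inverseˡ π-inj _)))

  Σ-signed-allowed :
    Σ[ allSubsets m ] (λ A → (- q) ^ ∣ A ∣ * ∏ (λ p → [1or0] (allowed p (onArm A (π p))))) ≈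
    ∏ (removeAt (ψs false I descents) valley)
  Σ-signed-allowed = begin
    Σ[ allSubsets m ] (λ A → (- q) ^ ∣ A ∣ * ∏ (λ p → [1or0] (allowed p (onArm A (π p)))))
      ≈⟨ Σ-cong (allSubsets m) (λ A →
           trans (*-cong (^-∣∣ (- q) A) (allowed-by-value A))
                 (sym (∏-distrib-* (λ j → sign (lookup A j)) (λ j → G j (lookup A j))))) ⟩
    Σ[ allSubsets m ] (λ A → ∏ (λ j → sign (lookup A j) * G j (lookup A j)))
      ≈⟨ Σ-allVecs-∏ (inside ∷ outside ∷ []) m (λ j c → sign c * G j c) ⟩
    ∏ (λ j → Σ[ inside ∷ outside ∷ [] ] (λ c → sign c * G j c))
      ≈⟨ ∏-cong (λ j → Σ-allowed (π⁻¹ (suc j))) ⟩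
    ∏ (λ j → ψs false I descents (π⁻¹ (suc j)))
      ≈⟨ ψs-by-value ⟩
    ∏ (removeAt (ψs false I descents) valley) ∎
    where
    sign : Bool → Carrier
    sign c = if c then - q else 1#
    G : Fin m → Bool → Carrier
    G j c = [1or0] (allowed (π⁻¹ (suc j)) c)

  𝐕⋆𝐁≈σ : (𝐕 q ⋆ 𝐁 I) π ≈ σ I descents
  𝐕⋆𝐁≈σ = begin
    (𝐕 q ⋆ 𝐁 I) π
      ≈⟨ 𝐕⋆-expansion q (𝐁 I) (λ f≗g → reflexive (≡.cong [1or0] (desSubsetB-cong f≗g I))) π π-inj ⟩
    Σ[ allSubsets m ] (λ A → (- q) ^ ∣ A ∣ * 𝐁 I (vPerm⁻¹ A ∘ π))
      ≈⟨ Σ-cong (allSubsets m) (λ A → *-congˡ (𝐁-vPerm⁻¹∘ A)) ⟩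
    Σ[ allSubsets m ] (λ A → (- q) ^ ∣ A ∣ * ∏ (λ p → [1or0] (allowed p (onArm A (π p)))))
      ≈⟨ Σ-signed-allowed ⟩
    ∏ (removeAt (ψs false I descents) valley)
      ≈⟨ ∏ψs-removeAt I descents valley ascentBefore-valley descentAfter-valley ⟩
    σ I descents ∎

module BlockSums {c ℓ} (R : CommutativeRing c ℓ) (q r : CommutativeRing.Carrier R)
                 (q*r≈1 : CommutativeRing._≈_ R (CommutativeRing._*_ R q r) (CommutativeRing.1# R)) where
  open CommutativeRing R hiding (zero)
  open Alg R
  open FiniteSums R
  open LocalFactors R q using (σ; α)
  open import Algebra.Properties.Ring ring
    using (-1*x≈-x; ⁻¹-anti-homo‿-; x[y-z]≈xy-xz; -‿+-comm; xyx⁻¹≈y; -0#≈0#)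
  open import Relation.Binary.Reasoning.Setoid setoid
  module *-Solver = Algebra.Solver.CommutativeMonoid *-commutativeMonoid
  open import Algebra.Properties.CommutativeSemigroup +-commutativeSemigroup
    using () renaming (interchange to +-interchange)
  open *-Solver using (_⊕_; _⊜_)

  [_] : ℕ → Carrier
  [ v ] = qint v r

  [1]≈1 : [ 1 ] ≈ 1#
  [1]≈1 = +-identityʳ 1#

  [1+v]≈1+r[v] : ∀ v → [ suc v ] ≈ 1# + r * [ v ]
  [1+v]≈1+r[v] v = +-congˡ (shift id v)
    where
    shift : ∀ (f : ℕ → ℕ) v → sumL (List.map (r ^_) (List.applyUpTo (suc ∘ f) v)) ≈
                               r * sumL (List.map (r ^_) (List.applyUpTo f v))
    shift f zero    = sym (zeroʳ r)
    shift f (suc v) = trans (+-congˡ (shift (f ∘ suc) v)) (sym (distribˡ r _ _))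

  ∏[_] : List ℕ → Carrier
  ∏[ vs ] = prodL (List.map [_] vs)

  summand : ∀ {k} → Subset k → Subset k → ℕ → Subset k → Carrier
  summand I D v K =
    [1or0] (does (I ⊆? K)) * ([1or0] (does (D ⊆? K)) * ((- 1#) ^ ∣ K ∣ * ∏[ blockEnds I K v ]))

  blockSum : ∀ {k} → Subset k → Subset k → ℕ → Carrier
  blockSum {k} I D v = Σ[ allSubsets k ] (summand I D v)

  private
    Σ-allSubsets-suc : ∀ {k} (f : Subset (suc k) → Carrier) →
                       Σ[ allSubsets (suc k) ] f ≈
                       Σ[ allSubsets k ] (f ∘ (true ∷_)) + Σ[ allSubsets k ] (f ∘ (false ∷_))
    Σ-allSubsets-suc {k} f = trans (Σ-allVecs-suc (inside ∷ outside ∷ []) k f) (+-congˡ (+-identityʳ _))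

    pull-sign : ∀ n a b s P → a * (b * ((n * s) * P)) ≈ n * (a * (b * (s * P)))
    pull-sign = *-Solver.solve 5 (λ n a b s P → a ⊕ (b ⊕ ((n ⊕ s) ⊕ P)) ⊜ n ⊕ (a ⊕ (b ⊕ (s ⊕ P)))) refl

    pull-sign-and-part : ∀ n v a b s P → a * (b * ((n * s) * (v * P))) ≈ n * (v * (a * (b * (s * P))))
    pull-sign-and-part = *-Solver.solve 6 (λ n v a b s P →
      a ⊕ (b ⊕ ((n ⊕ s) ⊕ (v ⊕ P))) ⊜ n ⊕ (v ⊕ (a ⊕ (b ⊕ (s ⊕ P))))) refl

  blockSum-[] : ∀ v → blockSum [] [] v ≈ [ v ]
  blockSum-[] v =
    trans (+-identityʳ _) (trans (*-identityˡ _) (trans (*-identityˡ _) (trans (*-identityˡ _) (*-identityʳ _))))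

  blockSum-inside : ∀ {k} d (I D : Subset k) v →
                    blockSum (true ∷ I) (d ∷ D) v ≈ - 1# * ([ v ] * blockSum I D 1)
  blockSum-inside {k} d I D v = begin
    blockSum (true ∷ I) (d ∷ D) v
      ≈⟨ Σ-allSubsets-suc (summand (true ∷ I) (d ∷ D) v) ⟩
    Σ[ allSubsets k ] (λ K → summand (true ∷ I) (d ∷ D) v (true ∷ K)) +
    Σ[ allSubsets k ] (λ K → summand (true ∷ I) (d ∷ D) v (false ∷ K))
      ≈⟨ +-cong (Σ-cong (allSubsets k) (inside-part d)) (Σ-zero (allSubsets k) (λ K → zeroˡ _)) ⟩
    Σ[ allSubsets k ] (λ K → - 1# * ([ v ] * summand I D 1 K)) + 0#
      ≈⟨ +-identityʳ _ ⟩
    Σ[ allSubsets k ] (λ K → - 1# * ([ v ] * summand I D 1 K))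
      ≈⟨ trans (Σ-*ˡ (allSubsets k) _ _) (*-congˡ (Σ-*ˡ (allSubsets k) _ _)) ⟩
    - 1# * ([ v ] * blockSum I D 1) ∎
    where
    inside-part : ∀ d K → summand (true ∷ I) (d ∷ D) v (true ∷ K) ≈ - 1# * ([ v ] * summand I D 1 K)
    inside-part true  K = pull-sign-and-part _ _ _ _ _ _
    inside-part false K = pull-sign-and-part _ _ _ _ _ _

  blockSum-descent : ∀ {k} (I D : Subset k) v → blockSum (false ∷ I) (true ∷ D) v ≈ - 1# * blockSum I D 1
  blockSum-descent {k} I D v = begin
    blockSum (false ∷ I) (true ∷ D) v
      ≈⟨ Σ-allSubsets-suc (summand (false ∷ I) (true ∷ D) v) ⟩
    Σ[ allSubsets k ] (λ K → summand (false ∷ I) (true ∷ D) v (true ∷ K)) +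
    Σ[ allSubsets k ] (λ K → summand (false ∷ I) (true ∷ D) v (false ∷ K))
      ≈⟨ +-cong (Σ-cong (allSubsets k) (λ K → pull-sign _ _ _ _ _))
                (Σ-zero (allSubsets k) (λ K → trans (*-congˡ (zeroˡ _)) (zeroʳ _))) ⟩
    Σ[ allSubsets k ] (λ K → - 1# * summand I D 1 K) + 0#
      ≈⟨ trans (+-identityʳ _) (Σ-*ˡ (allSubsets k) _ _) ⟩
    - 1# * blockSum I D 1 ∎

  blockSum-ascent : ∀ {k} (I D : Subset k) v →
                    blockSum (false ∷ I) (false ∷ D) v ≈ - 1# * blockSum I D 1 + blockSum I D (suc v)
  blockSum-ascent {k} I D v = trans (Σ-allSubsets-suc (summand (false ∷ I) (false ∷ D) v))
    (+-congʳ (trans (Σ-cong (allSubsets k) (λ K → pull-sign _ _ _ _ _)) (Σ-*ˡ (allSubsets k) _ _)))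

  scale : ∀ {k} → Subset k → Carrier
  scale {k} I = q ^ k * (1# - r) ^ ∣ I ∣

  private
    scale-inside : ∀ {k} (I : Subset k) → scale (true ∷ I) ≈ (q * (1# - r)) * scale I
    scale-inside {k} I = *-Solver.solve 4 (λ q Q u U → (q ⊕ Q) ⊕ (u ⊕ U) ⊜ (q ⊕ u) ⊕ (Q ⊕ U))
                                          refl q (q ^ k) (1# - r) ((1# - r) ^ ∣ I ∣)

    scale-outside : ∀ {k} (I : Subset k) → scale (false ∷ I) ≈ q * scale I
    scale-outside I = *-assoc _ _ _

    -1*q[1-r]≈1-q : - 1# * (q * (1# - r)) ≈ 1# - q
    -1*q[1-r]≈1-q = begin
      - 1# * (q * (1# - r)) ≈⟨ -1*x≈-x _ ⟩
      - (q * (1# - r))      ≈⟨ -‿cong (x[y-z]≈xy-xz q 1# r) ⟩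
      - (q * 1# - q * r)    ≈⟨ -‿cong (+-cong (*-identityʳ q) (-‿cong q*r≈1)) ⟩
      - (q - 1#)            ≈⟨ ⁻¹-anti-homo‿- q 1# ⟩
      1# - q                ∎

    [1+v]-[1]≈r[v] : ∀ v → [ suc v ] - [ 1 ] ≈ r * [ v ]
    [1+v]-[1]≈r[v] v = trans (+-cong ([1+v]≈1+r[v] v) (-‿cong [1]≈1)) (xyx⁻¹≈y 1# (r * [ v ]))

    x≈x+[y-y] : ∀ x y → x ≈ x + (y - y)
    x≈x+[y-y] x y = sym (trans (+-congˡ (-‿inverseʳ y)) (+-identityʳ x))

    x*[1]+[y-x]≈y : ∀ x y → x * [ 1 ] + (y - x) ≈ y
    x*[1]+[y-x]≈y x y = trans (+-congʳ (trans (*-congˡ [1]≈1) (*-identityʳ x)))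
                              (trans (sym (+-assoc x y (- x))) (xyx⁻¹≈y x y))

    difference : ∀ a x y g → - 1# * (a * x + g) + (a * y + g) ≈ a * (y - x)
    difference a x y g = begin
      - 1# * (a * x + g) + (a * y + g)   ≈⟨ +-congʳ (trans (-1*x≈-x _) (sym (-‿+-comm _ _))) ⟩
      (- (a * x) + - g) + (a * y + g)    ≈⟨ +-interchange _ _ _ _ ⟩
      (- (a * x) + a * y) + (- g + g)    ≈⟨ trans (+-cong (+-comm _ _) (-‿inverseˡ g)) (+-identityʳ _) ⟩
      a * y - a * x                      ≈⟨ x[y-z]≈xy-xz a y x ⟨
      a * (y - x)                        ∎

  -- It has to hold for every v because blockSum-ascent passes to a longer current part.
  Invariant : ∀ {k} → Subset k → Subset k → ℕ → Set ℓ
  Invariant I D v = scale I * blockSum I D v ≈ α I D * [ v ] + (σ I D - α I D)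

  Invariant₁ : ∀ {k} {I D : Subset k} → Invariant I D 1 → scale I * blockSum I D 1 ≈ σ I D
  Invariant₁ inv = trans inv (x*[1]+[y-x]≈y _ _)

  invariant-[] : ∀ v → Invariant [] [] v
  invariant-[] v = trans (*-cong (*-identityˡ 1#) (blockSum-[] v)) (x≈x+[y-y] _ 1#)

  invariant-inside : ∀ {k} d (I D : Subset k) v → Invariant I D 1 → Invariant (true ∷ I) (d ∷ D) v
  invariant-inside d I D v inv₁ = begin
    scale (true ∷ I) * blockSum (true ∷ I) (d ∷ D) v
      ≈⟨ *-cong (scale-inside I) (blockSum-inside d I D v) ⟩
    ((q * (1# - r)) * scale I) * (- 1# * ([ v ] * blockSum I D 1))
      ≈⟨ *-Solver.solve 5 (λ x s n v S → (x ⊕ s) ⊕ (n ⊕ (v ⊕ S)) ⊜ ((n ⊕ x) ⊕ (s ⊕ S)) ⊕ v)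
                          refl (q * (1# - r)) (scale I) (- 1#) [ v ] (blockSum I D 1) ⟩
    ((- 1# * (q * (1# - r))) * (scale I * blockSum I D 1)) * [ v ]
      ≈⟨ *-congʳ (*-cong -1*q[1-r]≈1-q (Invariant₁ {I = I} {D} inv₁)) ⟩
    ((1# - q) * σ I D) * [ v ]
      ≈⟨ x≈x+[y-y] _ _ ⟩
    ((1# - q) * σ I D) * [ v ] + ((1# - q) * σ I D - (1# - q) * σ I D) ∎

  invariant-descent : ∀ {k} (I D : Subset k) v → Invariant I D 1 → Invariant (false ∷ I) (true ∷ D) v
  invariant-descent I D v inv₁ = begin
    scale (false ∷ I) * blockSum (false ∷ I) (true ∷ D) v
      ≈⟨ *-cong (scale-outside I) (blockSum-descent I D v) ⟩
    (q * scale I) * (- 1# * blockSum I D 1)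
      ≈⟨ *-Solver.solve 4 (λ q s n S → (q ⊕ s) ⊕ (n ⊕ S) ⊜ (n ⊕ q) ⊕ (s ⊕ S))
                          refl q (scale I) (- 1#) (blockSum I D 1) ⟩
    (- 1# * q) * (scale I * blockSum I D 1)
      ≈⟨ *-cong (-1*x≈-x q) (Invariant₁ {I = I} {D} inv₁) ⟩
    (- q) * σ I D
      ≈⟨ trans (+-cong (zeroˡ _) (trans (+-congˡ -0#≈0#) (+-identityʳ _))) (+-identityˡ _) ⟨
    0# * [ v ] + ((- q) * σ I D - 0#) ∎

  invariant-ascent : ∀ {k} (I D : Subset k) v → Invariant I D 1 → Invariant I D (suc v) →
                     Invariant (false ∷ I) (false ∷ D) v
  invariant-ascent I D v inv₁ inv₁₊ᵥ = begin
    scale (false ∷ I) * blockSum (false ∷ I) (false ∷ D) v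
      ≈⟨ *-cong (scale-outside I) (blockSum-ascent I D v) ⟩
    q * scale I * (- 1# * blockSum I D 1 + blockSum I D (suc v))
      ≈⟨ trans (*-assoc _ _ _) (*-congˡ (trans (distribˡ _ _ _) (+-congʳ (x*[y*z]≈y*[x*z] _ _ _)))) ⟩
    q * (- 1# * (scale I * blockSum I D 1) + scale I * blockSum I D (suc v))
      ≈⟨ *-congˡ (+-cong (*-congˡ inv₁) inv₁₊ᵥ) ⟩
    q * (- 1# * (α I D * [ 1 ] + (σ I D - α I D)) + (α I D * [ suc v ] + (σ I D - α I D)))
      ≈⟨ *-congˡ (trans (difference _ _ _ _) (*-congˡ ([1+v]-[1]≈r[v] v))) ⟩
    q * (α I D * (r * [ v ]))
      ≈⟨ x*[y*z]≈y*[x*z] _ _ _ ⟩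
    α I D * (q * (r * [ v ]))
      ≈⟨ *-congˡ (trans (sym (*-assoc _ _ _)) (trans (*-congʳ q*r≈1) (*-identityˡ _))) ⟩
    α I D * [ v ]
      ≈⟨ x≈x+[y-y] _ _ ⟩
    α I D * [ v ] + (α I D - α I D) ∎

  invariant : ∀ {k} (I D : Subset k) v → Invariant I D v
  invariant []          []          v = invariant-[] v
  invariant (true  ∷ I) (d     ∷ D) v = invariant-inside d I D v (invariant I D 1)
  invariant (false ∷ I) (true  ∷ D) v = invariant-descent I D v (invariant I D 1)
  invariant (false ∷ I) (false ∷ D) v = invariant-ascent I D v (invariant I D 1) (invariant I D (suc v))

  coefficient : ∀ {k} → Subset k → Subset k → Carrier
  coefficient {k} I K = ((- 1#) ^ ∣ K ∣ * q ^ k) * ((1# - r) ^ ∣ I ∣ * ∏[ overline K I ])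

  Σ-coefficient : ∀ {k} (I D : Subset k) →
                  Σ[ allSubsets k ] (λ K → ([1or0] (does (I ⊆? K)) * coefficient I K) * [1or0] (does (D ⊆? K)))
                    ≈ σ I D
  Σ-coefficient {k} I D = begin
    Σ[ allSubsets k ] (λ K → ([1or0] (does (I ⊆? K)) * coefficient I K) * [1or0] (does (D ⊆? K)))
      ≈⟨ Σ-cong (allSubsets k) per-K ⟩
    Σ[ allSubsets k ] (λ K → scale I * summand I D 1 K)
      ≈⟨ Σ-*ˡ (allSubsets k) _ _ ⟩
    scale I * blockSum I D 1
      ≈⟨ Invariant₁ {I = I} {D} (invariant I D 1) ⟩
    σ I D ∎
    where
    on-⊆ : ∀ K → [1or0] (does (I ⊆? K)) * ∏[ overline K I ] ≈ [1or0] (does (I ⊆? K)) * ∏[ blockEnds I K 1 ]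
    on-⊆ K with I ⊆? K
    ... | yes I⊆K = *-congˡ (reflexive (≡.cong ∏[_] (overline≡blockEnds I⊆K)))
    ... | no  _   = trans (zeroˡ _) (sym (zeroˡ _))
    per-K : ∀ K → ([1or0] (does (I ⊆? K)) * coefficient I K) * [1or0] (does (D ⊆? K)) ≈ scale I * summand I D 1 K
    per-K K = begin
      (a * coefficient I K) * b
        ≈⟨ *-Solver.solve 6 (λ a s Q U P b →
             (a ⊕ ((s ⊕ Q) ⊕ (U ⊕ P))) ⊕ b ⊜ ((Q ⊕ U) ⊕ s) ⊕ ((a ⊕ P) ⊕ b)) refl _ _ _ _ _ _ ⟩
      (scale I * (- 1#) ^ ∣ K ∣) * ((a * ∏[ overline K I ]) * b)
        ≈⟨ *-congˡ (*-congʳ (on-⊆ K)) ⟩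
      (scale I * (- 1#) ^ ∣ K ∣) * ((a * ∏[ blockEnds I K 1 ]) * b)
        ≈⟨ *-Solver.solve 6 (λ Q U s a P b →
             ((Q ⊕ U) ⊕ s) ⊕ ((a ⊕ P) ⊕ b) ⊜ (Q ⊕ U) ⊕ (a ⊕ (b ⊕ (s ⊕ P)))) refl _ _ _ _ _ _ ⟩
      scale I * summand I D 1 K ∎
      where
      a b : Carrier
      a = [1or0] (does (I ⊆? K))
      b = [1or0] (does (D ⊆? K))


theorem2p4 : ∀ {c ℓ : Level} (R : CommutativeRing c ℓ) →
    let open CommutativeRing R
        open Alg R
    in (m : ℕ) (q q⁻¹ : Carrier) → q * q⁻¹ ≈ 1# → (I : Subset m) →
       ∃ λ (coef : Subset m → Carrier) →
         ((π : Map (suc m)) → Injective _≡_ _≡_ π →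
            (𝐕 q ⋆ 𝐁 I) π ≈ sumL (map (λ K → coef K * 𝐁 K π) (allSubsets m)))
         × (∀ K → ¬ (I ⊆ K) → coef K ≈ 0#)
         × (∀ K → I ⊆ K →
              coef K ≈ (((- 1#) ^ ∣ K ∣) * (q ^ m)) * (((1# - q⁻¹) ^ ∣ I ∣)
                         * prodL (map (λ v → qint v q⁻¹) (overline K I))))
theorem2p4 R m q q⁻¹ q*q⁻¹≈1 I = coef , expansion , vanishing , value
  where
  open CommutativeRing R hiding (zero)
  open Alg R
  open FiniteSums R
  open BlockSums R q q⁻¹ q*q⁻¹≈1 using (coefficient; Σ-coefficient)
  coef : Subset m → Carrier
  coef K = [1or0] (does (I ⊆? K)) * coefficient I K
  vanishing : ∀ K → ¬ (I ⊆ K) → coef K ≈ 0#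
  vanishing K I⊈K = trans (*-congʳ (reflexive (≡.cong [1or0] (dec-false (I ⊆? K) I⊈K)))) (zeroˡ _)
  value : ∀ K → I ⊆ K → coef K ≈ coefficient I K
  value K I⊆K = trans (*-congʳ (reflexive (≡.cong [1or0] (dec-true (I ⊆? K) I⊆K)))) (*-identityˡ _)
  expansion : (π : Map (suc m)) → Injective _≡_ _≡_ π →
              (𝐕 q ⋆ 𝐁 I) π ≈ sumL (map (λ K → coef K * 𝐁 K π) (allSubsets m))
  expansion π π-inj = begin
    (𝐕 q ⋆ 𝐁 I) π                                                   ≈⟨ 𝐕⋆𝐁≈σ ⟩
    σ I descents                                                    ≈⟨ Σ-coefficient I descents ⟨
    Σ[ allSubsets m ] (λ K → coef K * [1or0] (does (descents ⊆? K))) ≈⟨ Σ-cong (allSubsets m) B≡ ⟨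
    sumL (map (λ K → coef K * 𝐁 K π) (allSubsets m))                ∎
    where
    open import Relation.Binary.Reasoning.Setoid setoid
    open AtPermutation R q π-inj I using (𝐕⋆𝐁≈σ; descents)
    open LocalFactors R q using (σ)
    B≡ : ∀ K → coef K * 𝐁 K π ≈ coef K * [1or0] (does (descents ⊆? K))
    B≡ K = *-congˡ (reflexive (≡.cong [1or0] (desSubsetB≡⊆? π K)))
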